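{- For every integer $n\ge1$, the number of permutations $\pi$ of length $n$ such that the occurrence graph $G_{12}(\pi)$ is a tree equals $(n-1)^2$.
   Context: For a permutation $\pi$ of length $n$, $V_{12}(\pi)$ is the set of pairs $\{i,j\}$ with $1\le i<j\le n$ and $\pi(i)<\pi(j)$, and the occurrence graph $G_{12}(\pi)$ is the simple undirected graph with vertex set $V_{12}(\pi)$ in which two vertices are adjacent iff they share exactly one element. A tree is a graph with at least one vertex that is connected and has no cycles (the graph with no vertices is not a tree). -}

module Defs where

open import Data.Nat using (ℕ; _≤_; _∸_; _^_)
open import Data.Fin using (Fin; _<_)
open import Data.Vec using (Vec; lookup)
open import Data.List using (List; length; _++_; take)
open import Data.List.Membership.Propositional using (_∈_)
open import Data.List.Relation.Unary.All using (All)
open import Data.List.Relation.Unary.Linked using (Linked)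
open import Data.List.Relation.Unary.Unique.Propositional using (Unique)
open import Data.Product using (Σ; ∃; _×_)
open import Data.Sum using (_⊎_)
open import Relation.Nullary using (¬_)
open import Relation.Binary.PropositionalEquality using (_≡_; _≢_)
open import Function.Bundles using (_⇔_)

-- A permutation of length n: a bijection [n] → [n], given by its
-- one-line notation π = (π(0), …, π(n-1)) (0-indexed positions/values).
IsPerm : ∀ {n} → Vec (Fin n) n → Set
IsPerm {n} π =
  (∀ i j → lookup π i ≡ lookup π j → i ≡ j) ×
  (∀ y → ∃ λ i → lookup π i ≡ y)

-- Candidate vertex: the 2-set {i,j} encoded as the ordered pair (i , j), i < j.
Pair : ℕ → Set
Pair n = Fin n × Fin n

V12 : ∀ {n} → Vec (Fin n) n → Pair n → Set
V12 π (i Data.Product., j) = (i < j) × (lookup π i < lookup π j)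

ShareExactlyOne : ∀ {n} → Pair n → Pair n → Set
ShareExactlyOne (i Data.Product., j) (k Data.Product., l) =
  ((i Data.Product., j) ≢ (k Data.Product., l)) ×
  (i ≡ k ⊎ i ≡ l ⊎ j ≡ k ⊎ j ≡ l)

Adj12 : ∀ {n} → Vec (Fin n) n → Pair n → Pair n → Set
Adj12 π p q = V12 π p × V12 π q × ShareExactlyOne p q

data Walk {n} (π : Vec (Fin n) n) : Pair n → Pair n → Set where
  here : ∀ {u} → V12 π u → Walk π u u
  step : ∀ {u w v} → Adj12 π u w → Walk π w v → Walk π u v

Connected12 : ∀ {n} → Vec (Fin n) n → Set
Connected12 {n} π = ∀ (u v : Pair n) → V12 π u → V12 π v → Walk π u v

IsCycle12 : ∀ {n} → Vec (Fin n) n → List (Pair n) → Set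
IsCycle12 π cs =
  (3 ≤ length cs) × All (V12 π) cs × Unique cs ×
  Linked (Adj12 π) (cs ++ take 1 cs)

HasCycle12 : ∀ {n} → Vec (Fin n) n → Set
HasCycle12 {n} π = ∃ λ (cs : List (Pair n)) → IsCycle12 π cs

IsTree12 : ∀ {n} → Vec (Fin n) n → Set
IsTree12 {n} π = (∃ λ (u : Pair n) → V12 π u) × Connected12 π × ¬ HasCycle12 π

HasCount : ∀ {n} → (Vec (Fin n) n → Set) → ℕ → Set
HasCount {n} P m = Σ (List (Vec (Fin n) n)) λ L →
  Unique L × length L ≡ m × (∀ π → (π ∈ L) ⇔ P π)

-- The vertices of G₁₂(π) are the inversions of the complement g of π. A
-- position of g inverted with three others, a 321 or a 3412 in g gives a
-- cycle of length 3 or 4. Conversely, without these patterns no vertex {i,j}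
-- has two distinct neighbours of smaller weight i + j, so along a
-- non-backtracking walk the weight, once it rises, keeps rising, and there
-- is no cycle. Prepending entries one at a time shows that the
-- pattern-free g are the direct sums of fixed points and path blocks, with
-- one block of length 2 and two of each length m ≥ 3; G₁₂(π) is nonempty and
-- connected iff there is exactly one block. A block of length m sits in
-- n − m + 1 places, so there are (n − 1) + 2 ∑_{m=3}^{n} (n − m + 1) = (n − 1)²
-- trees.
module Submission where

open import Data.Nat as ℕ using (ℕ; zero; suc; z≤n; s≤s; _≤_; _+_; _*_; _∸_; _^_)
open import Data.Nat.Tactic.RingSolver using (solve-∀)
import Data.Nat.Properties as ℕ
open import Data.Fin as Fin using (Fin; zero; suc; toℕ; punchIn; punchOut; opposite; _<_; #_)
import Data.Fin.Properties as Fin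
open import Data.Vec as Vec using (Vec; []; _∷_; lookup; map; tabulate)
import Data.Vec.Properties as Vec
open import Data.Product using (Σ; ∃; _×_; _,_; proj₁; proj₂)
open import Data.Sum using (_⊎_; inj₁; inj₂)
open import Data.List as List using (List; []; _∷_; _++_; length; take)
open import Data.List.Membership.Propositional using (_∈_)
open import Data.List.Membership.Propositional.Properties using (∈-map⁺; ∈-map⁻; ∈-++⁺ˡ; ∈-++⁺ʳ; ∈-++⁻)
open import Data.List.Relation.Unary.Any using (here; there)
import Data.List.Relation.Unary.All as All
import Data.List.Relation.Unary.All.Properties as All
import Data.List.Properties as List
open import Data.List.Relation.Unary.Unique.Propositional using (Unique)
import Data.List.Relation.Unary.Unique.Propositional.Properties as Unique
open import Data.List.Relation.Unary.All using (All; []; _∷_)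
open import Data.List.Relation.Unary.AllPairs using (AllPairs; []; _∷_)
open import Data.List.Relation.Unary.Linked using (Linked; []; [-]; _∷_)
import Data.List.Relation.Unary.Linked as Linked
open import Data.Empty using (⊥; ⊥-elim)
open import Data.Unit using (⊤)
open import Function using (id; _∘_; _∋_)
open import Function.Bundles using (mk⇔)
open import Relation.Nullary using (¬_; Dec; yes; no)
open import Relation.Nullary.Decidable using (True; toWitness; _×-dec_; _⊎-dec_)
open import Relation.Binary using (tri<; tri≈; tri>)
open import Relation.Binary.PropositionalEquality
open import Defs

private variable n : ℕ

Perm : ℕ → Set
Perm n = Vec (Fin n) n

-- x ◂ τ is the permutation starting with x whose remaining entries are
-- order-isomorphic to τ.
infixr 5 _◂_
_◂_ : Fin (suc n) → Perm n → Perm (suc n)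
x ◂ τ = x ∷ map (punchIn x) τ

Inversion : Perm n → Fin n → Fin n → Set
Inversion g i j = i < j × lookup g j < lookup g i

Inverted : Perm n → Fin n → Fin n → Set
Inverted g p q = Inversion g p q ⊎ Inversion g q p

IsInversion : Perm n → Pair n → Set
IsInversion g (i , j) = Inversion g i j

complement : Perm n → Perm n
complement = map opposite

punchIn-mono-< : ∀ (x : Fin (suc n)) {j k} → j < k → punchIn x j < punchIn x k
punchIn-mono-< zero    j<k = s≤s j<k
punchIn-mono-< (suc x) {zero}  {suc k} j<k       = s≤s z≤n
punchIn-mono-< (suc x) {suc j} {suc k} (s≤s j<k) = s≤s (punchIn-mono-< x j<k)

punchIn-cancel-< : ∀ (x : Fin (suc n)) {j k} → punchIn x j < punchIn x k → j < k
punchIn-cancel-< zero    (s≤s j<k) = j<k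
punchIn-cancel-< (suc x) {zero}  {suc k} _         = s≤s z≤n
punchIn-cancel-< (suc x) {suc j} {suc k} (s≤s j<k) = s≤s (punchIn-cancel-< x j<k)

punchIn-<-fixed : ∀ (x : Fin (suc n)) {j} → toℕ j ℕ.< toℕ x → toℕ (punchIn x j) ≡ toℕ j
punchIn-<-fixed (suc x) {zero}  _         = refl
punchIn-<-fixed (suc x) {suc j} (s≤s j<x) = cong suc (punchIn-<-fixed x j<x)

punchIn-<-reflects : ∀ (x : Fin (suc n)) {j} → toℕ (punchIn x j) ℕ.< toℕ x → toℕ j ℕ.< toℕ x
punchIn-<-reflects (suc x) {zero}  _         = s≤s z≤n
punchIn-<-reflects (suc x) {suc j} (s≤s j<x) = s≤s (punchIn-<-reflects x j<x)

punchIn-≥-shifts : ∀ (x : Fin (suc n)) {j} → toℕ x ℕ.≤ toℕ j → toℕ (punchIn x j) ≡ suc (toℕ j)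
punchIn-≥-shifts zero    _         = refl
punchIn-≥-shifts (suc x) {suc j} (s≤s x≤j) = cong suc (punchIn-≥-shifts x x≤j)

punchIn-≤-suc : ∀ (x : Fin (suc n)) j → toℕ (punchIn x j) ℕ.≤ suc (toℕ j)
punchIn-≤-suc zero    j       = ℕ.≤-refl
punchIn-≤-suc (suc x) zero    = z≤n
punchIn-≤-suc (suc x) (suc j) = s≤s (punchIn-≤-suc x j)

lookup-◂ : ∀ (x : Fin (suc n)) τ j → lookup (x ◂ τ) (suc j) ≡ punchIn x (lookup τ j)
lookup-◂ x τ j = Vec.lookup-map j (punchIn x) τ

inversion-◂⁺ : ∀ x (τ : Perm n) {i j} → Inversion τ i j → Inversion (x ◂ τ) (suc i) (suc j)
inversion-◂⁺ x τ {i} {j} (i<j , τj<τi) = s≤s i<j ,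
  subst₂ _<_ (sym (lookup-◂ x τ j)) (sym (lookup-◂ x τ i)) (punchIn-mono-< x τj<τi)

inversion-◂⁻ : ∀ x (τ : Perm n) {i j} → Inversion (x ◂ τ) (suc i) (suc j) → Inversion τ i j
inversion-◂⁻ x τ {i} {j} (s≤s i<j , gj<gi) = i<j ,
  punchIn-cancel-< x (subst₂ _<_ (lookup-◂ x τ j) (lookup-◂ x τ i) gj<gi)

inverted-◂⁺ : ∀ x (τ : Perm n) {p q} → Inverted τ p q → Inverted (x ◂ τ) (suc p) (suc q)
inverted-◂⁺ x τ (inj₁ e) = inj₁ (inversion-◂⁺ x τ e)
inverted-◂⁺ x τ (inj₂ e) = inj₂ (inversion-◂⁺ x τ e)

inverted-◂⁻ : ∀ x (τ : Perm n) {p q} → Inverted (x ◂ τ) (suc p) (suc q) → Inverted τ p q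
inverted-◂⁻ x τ (inj₁ e) = inj₁ (inversion-◂⁻ x τ e)
inverted-◂⁻ x τ (inj₂ e) = inj₂ (inversion-◂⁻ x τ e)

inversion-◂-head⁻ : ∀ x (τ : Perm n) j → Inversion (x ◂ τ) zero (suc j) → lookup τ j < x
inversion-◂-head⁻ x τ j (_ , gj<x) = punchIn-<-reflects x (subst (_< x) (lookup-◂ x τ j) gj<x)

inversion-◂-head⁺ : ∀ x (τ : Perm n) j → lookup τ j < x → Inversion (x ◂ τ) zero (suc j)
inversion-◂-head⁺ x τ j τj<x = s≤s z≤n ,
  subst (_< x) (sym (lookup-◂ x τ j)) (subst (ℕ._< toℕ x) (sym (punchIn-<-fixed x τj<x)) τj<x)

Injective : Perm n → Set
Injective g = ∀ i j → lookup g i ≡ lookup g j → i ≡ j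

isPerm-◂ : ∀ x (τ : Perm n) → IsPerm τ → IsPerm (x ◂ τ)
isPerm-◂ x τ (inj , surj) = inj′ , surj′
  where
  inj′ : Injective (x ◂ τ)
  inj′ zero    zero    _  = refl
  inj′ zero    (suc j) eq = ⊥-elim (Fin.punchInᵢ≢i x (lookup τ j) (sym (trans eq (lookup-◂ x τ j))))
  inj′ (suc i) zero    eq = ⊥-elim (Fin.punchInᵢ≢i x (lookup τ i) (trans (sym (lookup-◂ x τ i)) eq))
  inj′ (suc i) (suc j) eq = cong suc (inj i j (Fin.punchIn-injective x _ _
    (trans (sym (lookup-◂ x τ i)) (trans eq (lookup-◂ x τ j)))))
  surj′ : ∀ y → ∃ λ i → lookup (x ◂ τ) i ≡ y
  surj′ y with x Fin.≟ y
  ... | yes x≡y = zero , x≡y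
  ... | no x≢y with surj (punchOut x≢y)
  ...   | j , τj≡y = suc j , trans (lookup-◂ x τ j) (trans (cong (punchIn x) τj≡y) (Fin.punchIn-punchOut x≢y))

◂-view : ∀ (g : Perm (suc n)) → IsPerm g → Σ (Fin (suc n)) λ x → Σ (Perm n) λ τ → g ≡ x ◂ τ × IsPerm τ
◂-view {n} (x ∷ ys) (inj , surj) = x , τ , cong (x ∷_) ys≡ , inj′ , surj′
  where
  x≢ : ∀ j → x ≢ lookup ys j
  x≢ j eq with inj zero (suc j) eq
  ... | ()
  τ : Perm n
  τ = tabulate (λ j → punchOut (x≢ j))
  lookup-τ : ∀ j → lookup τ j ≡ punchOut (x≢ j)
  lookup-τ = Vec.lookup∘tabulate _
  ys≡ : ys ≡ map (punchIn x) τ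
  ys≡ = begin
    ys                                        ≡⟨ Vec.tabulate∘lookup ys ⟨
    tabulate (lookup ys)                      ≡⟨ Vec.tabulate-cong (λ j → Fin.punchIn-punchOut (x≢ j)) ⟨
    tabulate (λ j → punchIn x (punchOut (x≢ j))) ≡⟨ Vec.tabulate-∘ (punchIn x) _ ⟩
    map (punchIn x) τ                         ∎
    where open ≡-Reasoning
  inj′ : Injective τ
  inj′ i j eq = Fin.suc-injective (inj (suc i) (suc j)
    (Fin.punchOut-injective (x≢ i) (x≢ j) (trans (sym (lookup-τ i)) (trans eq (lookup-τ j)))))
  surj′ : ∀ y → ∃ λ i → lookup τ i ≡ y
  surj′ y with surj (punchIn x y)
  ... | zero  , eq = ⊥-elim (Fin.punchInᵢ≢i x y (sym eq))
  ... | suc j , eq = j , trans (lookup-τ j) (trans (Fin.punchOut-cong x eq) (Fin.punchOut-punchIn x))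

lookup-complement : ∀ (g : Perm n) i → lookup (complement g) i ≡ opposite (lookup g i)
lookup-complement g i = Vec.lookup-map i opposite g

opposite-reverses : ∀ {a b : Fin n} → b < a → opposite a < opposite b
opposite-reverses {a = a} {b} b<a rewrite Fin.opposite-prop a | Fin.opposite-prop b =
  ℕ.∸-monoʳ-< (s≤s b<a) (Fin.toℕ<n a)

opposite-reflects : ∀ {a b : Fin n} → opposite a < opposite b → b < a
opposite-reflects {a = a} {b} oa<ob with Fin.<-cmp b a
... | tri< b<a _ _ = b<a
... | tri≈ _ refl _ = ⊥-elim (Fin.<-irrefl refl oa<ob)
... | tri> _ _ a<b = ⊥-elim (Fin.<-asym oa<ob (opposite-reverses a<b))

V12-complement⁻ : ∀ (g : Perm n) {u} → V12 (complement g) u → IsInversion g u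
V12-complement⁻ g {i , j} (i<j , gi<gj) = i<j ,
  opposite-reflects (subst₂ _<_ (lookup-complement g i) (lookup-complement g j) gi<gj)

V12-complement⁺ : ∀ (g : Perm n) {u} → IsInversion g u → V12 (complement g) u
V12-complement⁺ g {i , j} (i<j , gj<gi) = i<j ,
  subst₂ _<_ (sym (lookup-complement g i)) (sym (lookup-complement g j)) (opposite-reverses gj<gi)

opposite-injective : ∀ {a b : Fin n} → opposite a ≡ opposite b → a ≡ b
opposite-injective {a = a} {b} eq =
  trans (sym (Fin.opposite-involutive a)) (trans (cong opposite eq) (Fin.opposite-involutive b))

isPerm-complement : ∀ (g : Perm n) → IsPerm g → IsPerm (complement g)
isPerm-complement g (inj , surj) = inj′ , surj′
  where
  inj′ : Injective (complement g)
  inj′ i j eq = inj i j (opposite-injective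
    (trans (sym (lookup-complement g i)) (trans eq (lookup-complement g j))))
  surj′ : ∀ y → ∃ λ i → lookup (complement g) i ≡ y
  surj′ y with surj (opposite y)
  ... | j , eq = j , trans (lookup-complement g j) (trans (cong opposite eq) (Fin.opposite-involutive y))

complement-involutive : ∀ (g : Perm n) → complement (complement g) ≡ g
complement-involutive g = begin
  map opposite (map opposite g) ≡⟨ Vec.map-∘ opposite opposite g ⟨
  map (opposite ∘ opposite) g   ≡⟨ Vec.map-cong Fin.opposite-involutive g ⟩
  map id g                       ≡⟨ Vec.map-id g ⟩
  g                             ∎
  where open ≡-Reasoning

infix 4 _∈ₚ_
_∈ₚ_ : Fin n → Pair n → Set
x ∈ₚ (i , j) = i ≡ x ⊎ j ≡ x

shareExactlyOne : ∀ {x : Fin n} (u w : Pair n) → u ≢ w → x ∈ₚ u → x ∈ₚ w → ShareExactlyOne u w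
shareExactlyOne _ _ u≢w (inj₁ refl) (inj₁ refl) = u≢w , inj₁ refl
shareExactlyOne _ _ u≢w (inj₁ refl) (inj₂ refl) = u≢w , inj₂ (inj₁ refl)
shareExactlyOne _ _ u≢w (inj₂ refl) (inj₁ refl) = u≢w , inj₂ (inj₂ (inj₁ refl))
shareExactlyOne _ _ u≢w (inj₂ refl) (inj₂ refl) = u≢w , inj₂ (inj₂ (inj₂ refl))

sharedElement : ∀ (u w : Pair n) → ShareExactlyOne u w → Σ (Fin n) λ x → x ∈ₚ u × x ∈ₚ w
sharedElement (i , _) _ (_ , inj₁ refl)                = i , inj₁ refl , inj₁ refl
sharedElement (i , _) _ (_ , inj₂ (inj₁ refl))         = i , inj₁ refl , inj₂ refl
sharedElement (_ , j) _ (_ , inj₂ (inj₂ (inj₁ refl)))  = j , inj₂ refl , inj₁ refl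
sharedElement (_ , j) _ (_ , inj₂ (inj₂ (inj₂ refl)))  = j , inj₂ refl , inj₂ refl

shareExactlyOne-sym : ∀ (u w : Pair n) → ShareExactlyOne u w → ShareExactlyOne w u
shareExactlyOne-sym u w s with sharedElement u w s
... | _ , x∈u , x∈w = shareExactlyOne w u (proj₁ s ∘ sym) x∈w x∈u

∈ₚ-suc : ∀ {x : Fin n} {i j} → x ∈ₚ (i , j) → suc x ∈ₚ (suc i , suc j)
∈ₚ-suc (inj₁ refl) = inj₁ refl
∈ₚ-suc (inj₂ refl) = inj₂ refl

shareExactlyOne-suc : ∀ {n} {i j k l : Fin n} →
  ShareExactlyOne (i , j) (k , l) → ShareExactlyOne {suc n} (suc i , suc j) (suc k , suc l)
shareExactlyOne-suc {n} {i} {j} {k} {l} s with sharedElement (i , j) (k , l) s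
... | _ , x∈u , x∈w = shareExactlyOne _ _ (proj₁ s ∘ suc-pair-injective) (∈ₚ-suc x∈u) (∈ₚ-suc x∈w)
  where
  suc-pair-injective : (Pair (suc n) ∋ (suc i , suc j)) ≡ (suc k , suc l) → (i , j) ≡ (k , l)
  suc-pair-injective refl = refl

module _ {π : Perm n} where

  Adj12-sym : ∀ {u w} → Adj12 π u w → Adj12 π w u
  Adj12-sym {u} {w} (u∈V , w∈V , s) = w∈V , u∈V , shareExactlyOne-sym u w s

  _++ʷ_ : ∀ {u v w} → Walk π u v → Walk π v w → Walk π u w
  here _   ++ʷ q = q
  step a p ++ʷ q = step a (p ++ʷ q)

  reverseʷ : ∀ {u v} → Walk π u v → Walk π v u
  reverseʷ (here u∈V)  = here u∈V
  reverseʷ (step a p)  = reverseʷ p ++ʷ step (Adj12-sym a) (here (proj₁ a))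

  walk-preserves : (Q : Pair n → Set) → (∀ {u w} → Adj12 π u w → Q u → Q w) →
                   ∀ {u v} → Walk π u v → Q u → Q v
  walk-preserves Q step-Q (here _)   q = q
  walk-preserves Q step-Q (step a p) q = walk-preserves Q step-Q p (step-Q a q)

-- Short cycles

record ShortCycleFree (g : Perm n) : Set where
  field
    degree≤2   : ∀ p q₁ q₂ q₃ → Inverted g p q₁ → Inverted g p q₂ → Inverted g p q₃ →
                 q₁ ≢ q₂ → q₁ ≢ q₃ → q₂ ≢ q₃ → ⊥
    avoids321  : ∀ i j k → Inversion g i j → Inversion g j k → ⊥
    avoids3412 : ∀ a b c d → a < b → b < c → c < d →
                 lookup g c < lookup g d → lookup g d < lookup g a → lookup g a < lookup g b → ⊥

module ShortCycles (g : Perm n) where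

  private
    adjacent : ∀ {x} u w → IsInversion g u → IsInversion g w → u ≢ w → x ∈ₚ u → x ∈ₚ w →
               Adj12 (complement g) u w
    adjacent u w u-inv w-inv u≢w x∈u x∈w =
      V12-complement⁺ g u-inv , V12-complement⁺ g w-inv , shareExactlyOne u w u≢w x∈u x∈w

  triangle : ∀ u v w {a b c} → IsInversion g u → IsInversion g v → IsInversion g w →
             u ≢ v → u ≢ w → v ≢ w →
             a ∈ₚ u → a ∈ₚ v → b ∈ₚ v → b ∈ₚ w → c ∈ₚ w → c ∈ₚ u → HasCycle12 (complement g)
  triangle u v w iu iv iw u≢v u≢w v≢w au av bv bw cw cu =
    u ∷ v ∷ w ∷ [] , s≤s (s≤s (s≤s z≤n)) ,
    V12-complement⁺ g iu ∷ V12-complement⁺ g iv ∷ V12-complement⁺ g iw ∷ [] ,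
    (u≢v ∷ u≢w ∷ []) ∷ (v≢w ∷ []) ∷ [] ∷ [] ,
    adjacent u v iu iv u≢v au av ∷ adjacent v w iv iw v≢w bv bw ∷
    adjacent w u iw iu (u≢w ∘ sym) cw cu ∷ [-]

  square : ∀ u v w z {a b c d} → IsInversion g u → IsInversion g v → IsInversion g w → IsInversion g z →
           u ≢ v → u ≢ w → u ≢ z → v ≢ w → v ≢ z → w ≢ z →
           a ∈ₚ u → a ∈ₚ v → b ∈ₚ v → b ∈ₚ w → c ∈ₚ w → c ∈ₚ z → d ∈ₚ z → d ∈ₚ u →
           HasCycle12 (complement g)
  square u v w z iu iv iw iz u≢v u≢w u≢z v≢w v≢z w≢z au av bv bw cw cz dz du =
    u ∷ v ∷ w ∷ z ∷ [] , s≤s (s≤s (s≤s z≤n)) ,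
    V12-complement⁺ g iu ∷ V12-complement⁺ g iv ∷ V12-complement⁺ g iw ∷ V12-complement⁺ g iz ∷ [] ,
    (u≢v ∷ u≢w ∷ u≢z ∷ []) ∷ (v≢w ∷ v≢z ∷ []) ∷ (w≢z ∷ []) ∷ [] ∷ [] ,
    adjacent u v iu iv u≢v au av ∷ adjacent v w iv iw v≢w bv bw ∷
    adjacent w z iw iz w≢z cw cz ∷ adjacent z u iz iu (u≢z ∘ sym) dz du ∷ [-]

  private
    pairOf : ∀ {p q} → Inverted g p q → Pair n
    pairOf {p} {q} (inj₁ _) = p , q
    pairOf {p} {q} (inj₂ _) = q , p

    pairOf-inversion : ∀ {p q} (h : Inverted g p q) → IsInversion g (pairOf h)
    pairOf-inversion (inj₁ e) = e
    pairOf-inversion (inj₂ e) = e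

    ∈-pairOfˡ : ∀ {p q} (h : Inverted g p q) → p ∈ₚ pairOf h
    ∈-pairOfˡ (inj₁ _) = inj₁ refl
    ∈-pairOfˡ (inj₂ _) = inj₂ refl

    pairOf-injective : ∀ {p q₁ q₂} (h₁ : Inverted g p q₁) (h₂ : Inverted g p q₂) →
                       q₁ ≢ q₂ → pairOf h₁ ≢ pairOf h₂
    pairOf-injective (inj₁ (p<q₁ , _)) (inj₁ _) q₁≢q₂ refl = q₁≢q₂ refl
    pairOf-injective (inj₁ (p<q₁ , _)) (inj₂ _) q₁≢q₂ refl = Fin.<-irrefl refl p<q₁
    pairOf-injective (inj₂ (q₁<p , _)) (inj₁ _) q₁≢q₂ refl = Fin.<-irrefl refl q₁<p
    pairOf-injective (inj₂ (q₁<p , _)) (inj₂ _) q₁≢q₂ refl = q₁≢q₂ refl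

    fst-≢ : ∀ {a b c d : Fin n} → a ≢ c → (a , b) ≢ (c , d)
    fst-≢ a≢c = a≢c ∘ cong proj₁

    snd-≢ : ∀ {a b c d : Fin n} → b ≢ d → (a , b) ≢ (c , d)
    snd-≢ b≢d = b≢d ∘ cong proj₂

  acyclic⇒shortCycleFree : ¬ HasCycle12 (complement g) → ShortCycleFree g
  acyclic⇒shortCycleFree acyclic = record
    { degree≤2   = λ p q₁ q₂ q₃ h₁ h₂ h₃ q₁≢q₂ q₁≢q₃ q₂≢q₃ → acyclic
        (triangle (pairOf h₁) (pairOf h₂) (pairOf h₃)
          (pairOf-inversion h₁) (pairOf-inversion h₂) (pairOf-inversion h₃)
          (pairOf-injective h₁ h₂ q₁≢q₂) (pairOf-injective h₁ h₃ q₁≢q₃) (pairOf-injective h₂ h₃ q₂≢q₃)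
          (∈-pairOfˡ h₁) (∈-pairOfˡ h₂) (∈-pairOfˡ h₂) (∈-pairOfˡ h₃) (∈-pairOfˡ h₃) (∈-pairOfˡ h₁))
    ; avoids321  = λ i j k (i<j , gj<gi) (j<k , gk<gj) → acyclic
        (triangle (i , j) (j , k) (i , k) (i<j , gj<gi) (j<k , gk<gj)
          (Fin.<-trans i<j j<k , Fin.<-trans gk<gj gj<gi)
          (fst-≢ (Fin.<⇒≢ i<j)) (snd-≢ (Fin.<⇒≢ j<k)) (fst-≢ (Fin.<⇒≢ i<j ∘ sym))
          (inj₂ refl) (inj₁ refl) (inj₂ refl) (inj₂ refl) (inj₁ refl) (inj₁ refl))
    ; avoids3412 = λ a b c d a<b b<c c<d gc<gd gd<ga ga<gb →
        let a<c = Fin.<-trans a<b b<c in acyclic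
        (square (a , c) (a , d) (b , d) (b , c)
          (a<c , Fin.<-trans gc<gd gd<ga) (Fin.<-trans a<c c<d , gd<ga)
          (Fin.<-trans b<c c<d , Fin.<-trans gd<ga ga<gb)
          (b<c , Fin.<-trans gc<gd (Fin.<-trans gd<ga ga<gb))
          (snd-≢ (Fin.<⇒≢ c<d)) (fst-≢ (Fin.<⇒≢ a<b)) (fst-≢ (Fin.<⇒≢ a<b))
          (fst-≢ (Fin.<⇒≢ a<b)) (fst-≢ (Fin.<⇒≢ a<b)) (snd-≢ (Fin.<⇒≢ c<d ∘ sym))
          (inj₁ refl) (inj₁ refl) (inj₂ refl) (inj₂ refl) (inj₁ refl) (inj₁ refl) (inj₂ refl) (inj₂ refl))
    }

-- Short-cycle-free permutations give acyclic graphs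

-- Along a non-backtracking walk the weight cannot rise and then fall, as
-- the top vertex would have two distinct lower neighbours; so no walk
-- returns to its start.
module UniqueDescent {A : Set} (R : A → A → Set) (f : A → ℕ)
  (R-sym : ∀ {x y} → R x y → R y x)
  (R-separates : ∀ {x y} → R x y → f x ℕ.< f y ⊎ f y ℕ.< f x)
  (lower-unique : ∀ {y x z} → R y x → R y z → f x ℕ.< f y → f z ℕ.< f y → x ≡ z) where

  NonBacktracking : List A → Set
  NonBacktracking (x ∷ y ∷ z ∷ zs) = x ≢ z × NonBacktracking (y ∷ z ∷ zs)
  NonBacktracking _                = ⊤

  LastStepDescends : List A → Set
  LastStepDescends (x ∷ y ∷ [])     = f y ℕ.< f x
  LastStepDescends (x ∷ y ∷ z ∷ zs) = LastStepDescends (y ∷ z ∷ zs)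
  LastStepDescends _                = ⊥

  ascends : ∀ x y zs → Linked R (x ∷ y ∷ zs) → NonBacktracking (x ∷ y ∷ zs) →
            f x ℕ.< f y → All (λ z → f x ℕ.< f z) (y ∷ zs)
  ascends x y []       _                 _          x<y = x<y ∷ []
  ascends x y (z ∷ zs) (rxy ∷ ryz ∷ rs) (x≢z , nb) x<y with R-separates ryz
  ... | inj₁ y<z = x<y ∷ All.map (ℕ.<-trans x<y) (ascends y z zs (ryz ∷ rs) nb y<z)
  ... | inj₂ z<y = ⊥-elim (x≢z (lower-unique (R-sym rxy) ryz x<y z<y))

  descends : ∀ x y zs → Linked R (x ∷ y ∷ zs) → NonBacktracking (x ∷ y ∷ zs) →
             LastStepDescends (x ∷ y ∷ zs) → All (λ z → f z ℕ.< f x) (y ∷ zs)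
  descends x y []       _                 _          y<x = y<x ∷ []
  descends x y (z ∷ zs) (rxy ∷ ryz ∷ rs) (x≢z , nb) last
    with descends y z zs (ryz ∷ rs) nb last | R-separates rxy
  ... | below-y | inj₂ y<x = y<x ∷ All.map (λ w<y → ℕ.<-trans w<y y<x) below-y
  ... | z<y ∷ _ | inj₁ x<y = ⊥-elim (x≢z (lower-unique (R-sym rxy) ryz x<y z<y))

  lastStepDescends-∷ : ∀ x ys → LastStepDescends ys → LastStepDescends (x ∷ ys)
  lastStepDescends-∷ x (y ∷ z ∷ zs) last = last

  lastStepDescends-++ : ∀ xs {a b} → f b ℕ.< f a → LastStepDescends (xs ++ a ∷ b ∷ [])
  lastStepDescends-++ []       b<a = b<a
  lastStepDescends-++ (x ∷ xs) b<a = lastStepDescends-∷ x (xs ++ _ ∷ _ ∷ []) (lastStepDescends-++ xs b<a)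

  private
    linked-snoc : ∀ xs {a b} → Linked R (xs ++ a ∷ []) → R a b → Linked R (xs ++ a ∷ b ∷ [])
    linked-snoc []           _         r = r ∷ [-]
    linked-snoc (x ∷ [])     (r₀ ∷ _)  r = r₀ ∷ r ∷ [-]
    linked-snoc (x ∷ y ∷ xs) (r₀ ∷ rs) r = r₀ ∷ linked-snoc (y ∷ xs) rs r

    nonBacktracking-snoc : ∀ x y ys {a b} → AllPairs _≢_ (x ∷ y ∷ ys) →
      All (a ≢_) (x ∷ y ∷ ys) → All (b ≢_) (y ∷ ys) → NonBacktracking (x ∷ y ∷ ys ++ a ∷ b ∷ [])
    nonBacktracking-snoc x y []       _ (a≢x ∷ _) (b≢y ∷ _) = a≢x ∘ sym , b≢y ∘ sym , _
    nonBacktracking-snoc x y (z ∷ ys) ((_ ∷ x≢z ∷ _) ∷ uniq) (_ ∷ a≢) (_ ∷ b≢) =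
      x≢z , nonBacktracking-snoc y z ys uniq a≢ b≢

  acyclic : ∀ cs → 3 ℕ.≤ length cs → AllPairs _≢_ cs → ¬ Linked R (cs ++ take 1 cs)
  acyclic []          ()
  acyclic (_ ∷ [])     (s≤s ())
  acyclic (_ ∷ _ ∷ []) (s≤s (s≤s ()))
  acyclic (c₀ ∷ c₁ ∷ c₂ ∷ cs) _ (c₀≢@(_ ∷ c₀≢c₂ ∷ _) ∷ uniq₁@(c₁≢ ∷ _)) linked@(r₀₁ ∷ _) =
    returns-to-start (R-separates r₀₁)
    where
    walk : Linked R (c₀ ∷ c₁ ∷ c₂ ∷ cs ++ c₀ ∷ c₁ ∷ [])
    walk = linked-snoc (c₀ ∷ c₁ ∷ c₂ ∷ cs) linked r₀₁
    nb : NonBacktracking (c₀ ∷ c₁ ∷ c₂ ∷ cs ++ c₀ ∷ c₁ ∷ [])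
    nb = c₀≢c₂ , nonBacktracking-snoc c₁ c₂ cs uniq₁ c₀≢ c₁≢
    returns-to-start : f c₀ ℕ.< f c₁ ⊎ f c₁ ℕ.< f c₀ → ⊥
    returns-to-start (inj₁ up) with All.++⁻ʳ (c₁ ∷ c₂ ∷ cs) (ascends c₀ c₁ _ walk nb up)
    ... | c₀<c₀ ∷ _ = ℕ.n≮n _ c₀<c₀
    returns-to-start (inj₂ down)
      with All.++⁻ʳ (c₁ ∷ c₂ ∷ cs)
             (descends c₀ c₁ _ walk nb (lastStepDescends-++ (c₀ ∷ c₁ ∷ c₂ ∷ cs) down))
    ... | c₀<c₀ ∷ _ = ℕ.n≮n _ c₀<c₀

module _ (g : Perm n) (inj : Injective g) (scf : ShortCycleFree g) where
  open ShortCycleFree scf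

  private
    Adjacent : Pair n → Pair n → Set
    Adjacent u w = IsInversion g u × IsInversion g w × ShareExactlyOne u w

    weight : Pair n → ℕ
    weight (i , j) = toℕ i + toℕ j

    weight-<ʳ : ∀ i {j l : Fin n} → j < l → weight (i , j) ℕ.< weight (i , l)
    weight-<ʳ i = ℕ.+-monoʳ-< (toℕ i)

    weight-<ˡ : ∀ {i k : Fin n} j → i < k → weight (i , j) ℕ.< weight (k , j)
    weight-<ˡ j = ℕ.+-monoˡ-< (toℕ j)

    weight-<-chain : ∀ {i j k : Fin n} → i < j → j < k → weight (i , j) ℕ.< weight (j , k)
    weight-<-chain {i} {j} {k} i<j j<k =
      subst (weight (i , j) ℕ.<_) (ℕ.+-comm (toℕ k) (toℕ j)) (weight-<ˡ j (Fin.<-trans i<j j<k))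

    <-or-> : ∀ {i j : Fin n} → i ≢ j → i < j ⊎ j < i
    <-or-> {i} {j} i≢j with Fin.<-cmp i j
    ... | tri< i<j _ _ = inj₁ i<j
    ... | tri≈ _ i≡j _ = ⊥-elim (i≢j i≡j)
    ... | tri> _ _ j<i = inj₂ j<i

    weight-separates : ∀ {u w} → Adjacent u w → weight u ℕ.< weight w ⊎ weight w ℕ.< weight u
    weight-separates {i , j} {_ , l} (_ , _ , u≢w , inj₁ refl) with <-or-> (u≢w ∘ cong (i ,_))
    ... | inj₁ j<l = inj₁ (weight-<ʳ i j<l)
    ... | inj₂ l<j = inj₂ (weight-<ʳ i l<j)
    weight-separates {i , j} {k , _} ((i<j , _) , (k<i , _) , _ , inj₂ (inj₁ refl)) =
      inj₂ (weight-<-chain k<i i<j)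
    weight-separates {i , j} {_ , l} ((i<j , _) , (j<l , _) , _ , inj₂ (inj₂ (inj₁ refl))) =
      inj₁ (weight-<-chain i<j j<l)
    weight-separates {i , j} {k , _} (_ , _ , u≢w , inj₂ (inj₂ (inj₂ refl))) with <-or-> (u≢w ∘ cong (_, j))
    ... | inj₁ i<k = inj₁ (weight-<ˡ j i<k)
    ... | inj₂ k<i = inj₂ (weight-<ˡ j k<i)

    LowerNeighbour : Pair n → Pair n → Set
    LowerNeighbour (i , j) (k , l) = (k ≡ i × l < j) ⊎ (l ≡ j × k < i)

    lowerNeighbour : ∀ {u w} → Adjacent u w → weight w ℕ.< weight u → LowerNeighbour u w
    lowerNeighbour {i , _} (_ , _ , _ , inj₁ refl) w<u = inj₁ (refl , ℕ.+-cancelˡ-< (toℕ i) _ _ w<u)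
    lowerNeighbour {i , j} {k , _} (u-inv , w-inv , _ , inj₂ (inj₁ refl)) _ =
      ⊥-elim (avoids321 k i j w-inv u-inv)
    lowerNeighbour {i , j} ((i<j , _) , (j<l , _) , _ , inj₂ (inj₂ (inj₁ refl))) w<u =
      ⊥-elim (ℕ.<-asym w<u (weight-<-chain i<j j<l))
    lowerNeighbour {_ , j} (_ , _ , _ , inj₂ (inj₂ (inj₂ refl))) w<u = inj₂ (refl , ℕ.+-cancelʳ-< (toℕ j) _ _ w<u)

    values-differ : ∀ {p q} → p ≢ q → lookup g p < lookup g q ⊎ lookup g q < lookup g p
    values-differ p≢q = <-or-> (p≢q ∘ inj _ _)

    -- {i,j} cannot have a lower neighbour of each kind.
    not-both-kinds : ∀ {i j b a} → Inversion g i j → Inversion g i b → b < j → Inversion g a j → a < i → ⊥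
    not-both-kinds {i} {j} {b} {a} ij ib b<j aj a<i
      with values-differ (Fin.<⇒≢ b<j) | values-differ (Fin.<⇒≢ a<i)
    ... | inj₂ gj<gb | _           = avoids321 i b j ib (b<j , gj<gb)
    ... | inj₁ _     | inj₂ gi<ga  = avoids321 a i j (a<i , gi<ga) ij
    ... | inj₁ gb<gj | inj₁ ga<gi  = avoids3412 a i b j a<i (proj₁ ib) b<j gb<gj (proj₂ aj) ga<gi

    lower-unique : ∀ {y x z} → Adjacent y x → Adjacent y z →
                   weight x ℕ.< weight y → weight z ℕ.< weight y → x ≡ z
    lower-unique {i , j} {_ , b} {_ , d} yx yz x<y z<y
      with lowerNeighbour yx x<y | lowerNeighbour yz z<y
    ... | inj₁ (refl , b<j) | inj₁ (refl , d<j) with b Fin.≟ d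
    ...   | yes refl = refl
    ...   | no b≢d   = ⊥-elim (degree≤2 i b d j (inj₁ (proj₁ (proj₂ yx))) (inj₁ (proj₁ (proj₂ yz)))
                                (inj₁ (proj₁ yx)) b≢d (Fin.<⇒≢ b<j) (Fin.<⇒≢ d<j))
    lower-unique {i , j} {a , _} {c , _} yx yz x<y z<y
        | inj₂ (refl , a<i) | inj₂ (refl , c<i) with a Fin.≟ c
    ...   | yes refl = refl
    ...   | no a≢c   = ⊥-elim (degree≤2 j a c i (inj₂ (proj₁ (proj₂ yx))) (inj₂ (proj₁ (proj₂ yz)))
                                (inj₂ (proj₁ yx)) a≢c (Fin.<⇒≢ a<i) (Fin.<⇒≢ c<i))
    lower-unique yx yz _ _ | inj₁ (refl , b<j) | inj₂ (refl , c<i) =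
      ⊥-elim (not-both-kinds (proj₁ yx) (proj₁ (proj₂ yx)) b<j (proj₁ (proj₂ yz)) c<i)
    lower-unique yx yz _ _ | inj₂ (refl , a<i) | inj₁ (refl , d<j) =
      ⊥-elim (not-both-kinds (proj₁ yx) (proj₁ (proj₂ yz)) d<j (proj₁ (proj₂ yx)) a<i)

    adjacent⁻ : ∀ {u w} → Adj12 (complement g) u w → Adjacent u w
    adjacent⁻ (u∈V , w∈V , s) = V12-complement⁻ g u∈V , V12-complement⁻ g w∈V , s

  shortCycleFree⇒acyclic : ¬ HasCycle12 (complement g)
  shortCycleFree⇒acyclic (cs , 3≤len , _ , uniq , linked) =
    acyclic cs 3≤len uniq (Linked.map adjacent⁻ linked)
    where
    Adjacent-sym : ∀ {u w} → Adjacent u w → Adjacent w u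
    Adjacent-sym {u} {w} (iu , iw , s) = iw , iu , shareExactlyOne-sym u w s
    open UniqueDescent Adjacent weight Adjacent-sym weight-separates lower-unique

-- Layouts

-- A layout lists, from left to right, the components of a direct sum of
-- fixed points and path blocks.
data Layout : ℕ → Set where
  []     : Layout 0
  fixed  : ∀ {r} → Layout r → Layout (suc r)
  blockA : ∀ {r} (k : ℕ) → Layout r → Layout (2 + k + r)
  blockB : ∀ {r} (k : ℕ) → Layout r → Layout (3 + k + r)

-- pathA k = 10, 201, 2031, 20413, 204153, … and pathB k = 120, 1302, …:
-- the indecomposable permutations whose inversions form a path.
pathA : ∀ {r} (k : ℕ) → Perm r → Perm (2 + k + r)
pathA zero          τ = # 1 ◂ # 0 ◂ τ
pathA (suc zero)    τ = # 2 ◂ # 0 ◂ # 0 ◂ τ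
pathA (suc (suc k)) τ = # 2 ◂ # 0 ◂ pathA k τ

pathB : ∀ {r} (k : ℕ) → Perm r → Perm (3 + k + r)
pathB k τ = # 1 ◂ pathA k τ

perm : Layout n → Perm n
perm []           = []
perm (fixed d)    = # 0 ◂ perm d
perm (blockA k d) = pathA k (perm d)
perm (blockB k d) = pathB k (perm d)

isPerm-pathA : ∀ {r} k (τ : Perm r) → IsPerm τ → IsPerm (pathA k τ)
isPerm-pathA zero          τ p = isPerm-◂ _ _ (isPerm-◂ _ _ p)
isPerm-pathA (suc zero)    τ p = isPerm-◂ _ _ (isPerm-◂ _ _ (isPerm-◂ _ _ p))
isPerm-pathA (suc (suc k)) τ p = isPerm-◂ _ _ (isPerm-◂ _ _ (isPerm-pathA k τ p))

isPerm-perm : ∀ (d : Layout n) → IsPerm (perm d)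
isPerm-perm []           = (λ ()) , (λ ())
isPerm-perm (fixed d)    = isPerm-◂ _ _ (isPerm-perm d)
isPerm-perm (blockA k d) = isPerm-pathA k _ (isPerm-perm d)
isPerm-perm (blockB k d) = isPerm-◂ _ _ (isPerm-pathA k _ (isPerm-perm d))

allFixed : ∀ n → Layout n
allFixed zero    = []
allFixed (suc n) = fixed (allFixed n)

-- How the layout of τ changes when a new first entry x is prepended; the
-- last clause is junk, never used for short-cycle-free permutations.
extend : Fin (suc n) → Layout n → Layout (suc n)
extend zero                   d                     = fixed d
extend (suc zero)             (fixed d)             = blockA 0 d
extend (suc zero)             (blockA k d)          = blockB k d
extend (suc (suc zero))       (fixed (fixed d))     = blockA 1 d
extend (suc (suc zero))       (fixed (blockA k d))  = blockA (2 + k) d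
extend {n}                    _                     _ = allFixed (suc n)

-- The inverse of punchIn x, with junk value zero at x itself.
punchOutᵗ : Fin (suc (suc n)) → Fin (suc (suc n)) → Fin (suc n)
punchOutᵗ x y with x Fin.≟ y
... | yes _   = zero
... | no x≢y  = punchOut x≢y

unshift : Fin (suc n) → Vec (Fin (suc n)) n → Perm n
unshift {zero}  _ []  = []
unshift {suc n} x ys  = map (punchOutᵗ x) ys

layout : Perm n → Layout n
layout []       = []
layout (x ∷ ys) = extend x (layout (unshift x ys))

unshift-punchIn : ∀ (x : Fin (suc n)) (τ : Perm n) → unshift x (map (punchIn x) τ) ≡ τ
unshift-punchIn {zero}  x [] = refl
unshift-punchIn {suc n} x τ = begin
  map (punchOutᵗ x) (map (punchIn x) τ) ≡⟨ Vec.map-∘ (punchOutᵗ x) (punchIn x) τ ⟨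
  map (punchOutᵗ x ∘ punchIn x) τ       ≡⟨ Vec.map-cong punchOutᵗ-punchIn τ ⟩
  map id τ                              ≡⟨ Vec.map-id τ ⟩
  τ                                     ∎
  where
  open ≡-Reasoning
  punchOutᵗ-punchIn : ∀ y → punchOutᵗ x (punchIn x y) ≡ y
  punchOutᵗ-punchIn y with x Fin.≟ punchIn x y
  ... | yes x≡ = ⊥-elim (Fin.punchInᵢ≢i x y (sym x≡))
  ... | no _   = trans (Fin.punchOut-cong x refl) (Fin.punchOut-punchIn x)

layout-◂ : ∀ (x : Fin (suc n)) τ → layout (x ◂ τ) ≡ extend x (layout τ)
layout-◂ x τ = cong (extend x ∘ layout) (unshift-punchIn x τ)

layout-pathA : ∀ {r} k (τ : Perm r) → layout (pathA k τ) ≡ blockA k (layout τ)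
layout-pathA zero τ =
  trans (layout-◂ (# 1) (# 0 ◂ τ)) (cong (extend (# 1)) (layout-◂ (# 0) τ))
layout-pathA (suc zero) τ =
  trans (layout-◂ (# 2) (# 0 ◂ # 0 ◂ τ))
    (cong (extend (# 2)) (trans (layout-◂ (# 0) (# 0 ◂ τ)) (cong fixed (layout-◂ (# 0) τ))))
layout-pathA (suc (suc k)) τ =
  trans (layout-◂ (# 2) (# 0 ◂ pathA k τ))
    (cong (extend (# 2)) (trans (layout-◂ (# 0) (pathA k τ)) (cong fixed (layout-pathA k τ))))

layout-perm : ∀ (d : Layout n) → layout (perm d) ≡ d
layout-perm []           = refl
layout-perm (fixed d)    = trans (layout-◂ (# 0) (perm d)) (cong fixed (layout-perm d))
layout-perm (blockA k d) = trans (layout-pathA k (perm d)) (cong (blockA k) (layout-perm d))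
layout-perm (blockB k d) = trans (layout-◂ (# 1) (pathA k (perm d)))
  (cong (extend (# 1)) (trans (layout-pathA k (perm d)) (cong (blockA k) (layout-perm d))))

perm-injective : ∀ {d d′ : Layout n} → perm d ≡ perm d′ → d ≡ d′
perm-injective {d = d} {d′} eq = trans (sym (layout-perm d)) (trans (cong layout eq) (layout-perm d′))

-- Classification of short-cycle-free permutations

inversion? : ∀ (g : Perm n) i j → Dec (Inversion g i j)
inversion? g i j = i Fin.<? j ×-dec lookup g j Fin.<? lookup g i

inverted? : ∀ (g : Perm n) p q → Dec (Inverted g p q)
inverted? g p q = inversion? g p q ⊎-dec inversion? g q p

-- On concrete positions of a concrete prefix the side conditions hold by
-- evaluation.
module _ {g : Perm n} (scf : ShortCycleFree g) where
  open ShortCycleFree scf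

  ¬degree≤2 : ∀ p q₁ q₂ q₃ {_ : True (q₁ Fin.<? q₂)} {_ : True (q₂ Fin.<? q₃)}
    {_ : True (inverted? g p q₁)} {_ : True (inverted? g p q₂)} {_ : True (inverted? g p q₃)} → ⊥
  ¬degree≤2 p q₁ q₂ q₃ {q₁<q₂} {q₂<q₃} {h₁} {h₂} {h₃} =
    degree≤2 p q₁ q₂ q₃ (toWitness h₁) (toWitness h₂) (toWitness h₃)
      (Fin.<⇒≢ (toWitness q₁<q₂)) (Fin.<⇒≢ (Fin.<-trans (toWitness q₁<q₂) (toWitness q₂<q₃)))
      (Fin.<⇒≢ (toWitness q₂<q₃))

  ¬avoids321 : ∀ i j k {_ : True (inversion? g i j)} {_ : True (inversion? g j k)} → ⊥
  ¬avoids321 i j k {ij} {jk} = avoids321 i j k (toWitness ij) (toWitness jk)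

  ¬avoids3412 : ∀ a b c d {_ : True (a Fin.<? b)} {_ : True (b Fin.<? c)} {_ : True (c Fin.<? d)}
    {_ : True (lookup g c Fin.<? lookup g d)} {_ : True (lookup g d Fin.<? lookup g a)}
    {_ : True (lookup g a Fin.<? lookup g b)} → ⊥
  ¬avoids3412 a b c d {ab} {bc} {cd} {v₁} {v₂} {v₃} = avoids3412 a b c d
    (toWitness ab) (toWitness bc) (toWitness cd) (toWitness v₁) (toWitness v₂) (toWitness v₃)

head<3 : ∀ (g : Perm (3 + n)) → IsPerm g → ShortCycleFree g → toℕ (lookup g zero) ℕ.< 3
head<3 g (_ , surj) scf = ℕ.≰⇒> three-smaller-values
  where
  from-head : ∀ p {v} → lookup g p ≡ v → v < lookup g zero → Inversion g zero p
  from-head zero    refl v<v = ⊥-elim (Fin.<-irrefl refl v<v)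
  from-head (suc p) refl v<g₀ = s≤s z≤n , v<g₀
  three-smaller-values : ¬ 3 ℕ.≤ toℕ (lookup g zero)
  three-smaller-values 3≤g₀ with surj zero | surj (# 1) | surj (# 2)
  ... | p₀ , g₀ | p₁ , g₁ | p₂ , g₂ = ShortCycleFree.degree≤2 scf zero p₀ p₁ p₂
    (inj₁ (from-head p₀ g₀ (ℕ.<-≤-trans (s≤s z≤n) 3≤g₀)))
    (inj₁ (from-head p₁ g₁ (ℕ.<-≤-trans (s≤s (s≤s z≤n)) 3≤g₀)))
    (inj₁ (from-head p₂ g₂ 3≤g₀))
    (λ { refl → Fin.0≢1+n (trans (sym g₀) g₁) })
    (λ { refl → Fin.0≢1+n (trans (sym g₀) g₂) })
    (λ { refl → Fin.0≢1+n (Fin.suc-injective (trans (sym g₁) g₂)) })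

-- Only the prefixes in the first five clauses are short-cycle-free; each of
-- the others exhibits a vertex of degree 3, a 321 or a 3412 among its first
-- five entries.
perm-extend : ∀ (x : Fin (suc n)) d → IsPerm (x ◂ perm d) → ShortCycleFree (x ◂ perm d) →
              perm (extend x d) ≡ x ◂ perm d
perm-extend zero             d                    _ _ = refl
perm-extend (suc zero)       (fixed d)            _ _ = refl
perm-extend (suc zero)       (blockA k d)         _ _ = refl
perm-extend (suc (suc zero)) (fixed (fixed d))    _ _ = refl
perm-extend (suc (suc zero)) (fixed (blockA k d)) _ _ = refl
perm-extend (suc (suc (suc x))) d p scf with head<3 _ p scf
... | s≤s (s≤s (s≤s ()))
perm-extend (suc zero) (blockB zero d)          _ scf = ⊥-elim (¬degree≤2 scf (# 3) (# 0) (# 1) (# 2))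
perm-extend (suc zero) (blockB (suc zero) d)    _ scf = ⊥-elim (¬degree≤2 scf (# 3) (# 0) (# 1) (# 2))
perm-extend (suc zero) (blockB (suc (suc k)) d) _ scf = ⊥-elim (¬degree≤2 scf (# 3) (# 0) (# 1) (# 2))
perm-extend (suc (suc zero)) (fixed (blockB zero d))          _ scf = ⊥-elim (¬degree≤2 scf (# 4) (# 0) (# 2) (# 3))
perm-extend (suc (suc zero)) (fixed (blockB (suc zero) d))    _ scf = ⊥-elim (¬degree≤2 scf (# 4) (# 0) (# 2) (# 3))
perm-extend (suc (suc zero)) (fixed (blockB (suc (suc k)) d)) _ scf = ⊥-elim (¬degree≤2 scf (# 4) (# 0) (# 2) (# 3))
perm-extend (suc (suc zero)) (blockA zero d)       _ scf = ⊥-elim (¬avoids321 scf (# 0) (# 1) (# 2))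
perm-extend (suc (suc zero)) (blockA (suc zero) d) _ scf = ⊥-elim (¬avoids3412 scf (# 0) (# 1) (# 2) (# 3))
perm-extend (suc (suc zero)) (blockA (suc (suc zero)) d)          _ scf = ⊥-elim (¬degree≤2 scf (# 4) (# 0) (# 1) (# 3))
perm-extend (suc (suc zero)) (blockA (suc (suc (suc zero))) d)    _ scf = ⊥-elim (¬degree≤2 scf (# 4) (# 0) (# 1) (# 3))
perm-extend (suc (suc zero)) (blockA (suc (suc (suc (suc k)))) d) _ scf = ⊥-elim (¬degree≤2 scf (# 4) (# 0) (# 1) (# 3))
perm-extend (suc (suc zero)) (blockB zero d)          _ scf = ⊥-elim (¬degree≤2 scf (# 3) (# 0) (# 1) (# 2))
perm-extend (suc (suc zero)) (blockB (suc zero) d)    _ scf = ⊥-elim (¬degree≤2 scf (# 3) (# 0) (# 1) (# 2))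
perm-extend (suc (suc zero)) (blockB (suc (suc k)) d) _ scf = ⊥-elim (¬degree≤2 scf (# 3) (# 0) (# 1) (# 2))

shortCycleFree-◂⁻ : ∀ x (τ : Perm n) → ShortCycleFree (x ◂ τ) → ShortCycleFree τ
shortCycleFree-◂⁻ x τ scf = record
  { degree≤2   = λ p q₁ q₂ q₃ h₁ h₂ h₃ q₁≢q₂ q₁≢q₃ q₂≢q₃ →
      degree≤2 (suc p) (suc q₁) (suc q₂) (suc q₃)
        (inverted-◂⁺ x τ h₁) (inverted-◂⁺ x τ h₂) (inverted-◂⁺ x τ h₃)
        (q₁≢q₂ ∘ Fin.suc-injective) (q₁≢q₃ ∘ Fin.suc-injective) (q₂≢q₃ ∘ Fin.suc-injective)
  ; avoids321  = λ i j k ij jk → avoids321 (suc i) (suc j) (suc k) (inversion-◂⁺ x τ ij) (inversion-◂⁺ x τ jk)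
  ; avoids3412 = λ a b c d a<b b<c c<d v₁ v₂ v₃ →
      avoids3412 (suc a) (suc b) (suc c) (suc d) (s≤s a<b) (s≤s b<c) (s≤s c<d)
        (lift c d v₁) (lift d a v₂) (lift a b v₃)
  }
  where
  open ShortCycleFree scf
  lift : ∀ u v → lookup τ u < lookup τ v → lookup (x ◂ τ) (suc u) < lookup (x ◂ τ) (suc v)
  lift u v τu<τv = subst₂ _<_ (sym (lookup-◂ x τ u)) (sym (lookup-◂ x τ v)) (punchIn-mono-< x τu<τv)

perm-layout : ∀ (g : Perm n) → IsPerm g → ShortCycleFree g → perm (layout g) ≡ g
perm-layout []      _  _   = refl
perm-layout g@(_ ∷ _) pg scf with ◂-view g pg
... | x , τ , refl , pτ = begin
  perm (layout (x ◂ τ))      ≡⟨ cong perm (layout-◂ x τ) ⟩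
  perm (extend x (layout τ)) ≡⟨ perm-extend′ (perm-layout τ pτ (shortCycleFree-◂⁻ x τ scf)) ⟩
  x ◂ τ                      ∎
  where
  open ≡-Reasoning
  perm-extend′ : ∀ {d} → perm d ≡ τ → perm (extend x d) ≡ x ◂ τ
  perm-extend′ refl = perm-extend x _ pg scf

-- Layout permutations are short-cycle-free

below-two-chain : ∀ {a b c} → a ℕ.< b → b ℕ.< c → c ℕ.≤ 2 → a ≡ 0 × c ≡ 2
below-two-chain (s≤s z≤n) (s≤s (s≤s z≤n)) (s≤s (s≤s z≤n)) = refl , refl

pigeonhole : ∀ {a b c} → a ℕ.< 2 → b ℕ.< 2 → c ℕ.< 2 → a ≡ b ⊎ a ≡ c ⊎ b ≡ c
pigeonhole (s≤s z≤n)       (s≤s z≤n)       _               = inj₁ refl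
pigeonhole (s≤s (s≤s z≤n)) (s≤s (s≤s z≤n)) _               = inj₁ refl
pigeonhole (s≤s z≤n)       (s≤s (s≤s z≤n)) (s≤s z≤n)       = inj₂ (inj₁ refl)
pigeonhole (s≤s z≤n)       (s≤s (s≤s z≤n)) (s≤s (s≤s z≤n)) = inj₂ (inj₂ refl)
pigeonhole (s≤s (s≤s z≤n)) (s≤s z≤n)       (s≤s z≤n)       = inj₂ (inj₂ refl)
pigeonhole (s≤s (s≤s z≤n)) (s≤s z≤n)       (s≤s (s≤s z≤n)) = inj₂ (inj₁ refl)

-- Prepending x adds the inversions (0, j+1) with τ j < x; these conditions
-- keep every degree at most 2 and create no 321 or 3412.
record Prependable (x : Fin (suc n)) (τ : Perm n) : Set where
  field
    x≤2            : toℕ x ℕ.≤ 2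
    unique-partner : ∀ j → lookup τ j < x → ∀ {q q′} → Inverted τ j q → Inverted τ j q′ → q ≡ q′
    zero-first     : toℕ x ≡ 2 → ∀ j → toℕ (lookup τ j) ≡ 0 → toℕ j ≡ 0

module _ {x : Fin (suc n)} {τ : Perm n} (pτ : IsPerm τ) (scf : ShortCycleFree τ) (pre : Prependable x τ) where
  open Prependable pre
  private
    inj : Injective τ
    inj = proj₁ pτ
    g : Perm (suc n)
    g = x ◂ τ
    module τ = ShortCycleFree scf

    <x⇒<2 : ∀ {a} → a ℕ.< toℕ x → a ℕ.< 2
    <x⇒<2 a<x = ℕ.<-≤-trans a<x x≤2

    inverted-head : ∀ {q} → Inverted g zero q → ∃ λ j → q ≡ suc j × lookup τ j < x
    inverted-head {suc j} (inj₁ e) = j , refl , inversion-◂-head⁻ x τ j e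

    inverted-tail : ∀ {j q} → Inverted g (suc j) q →
      (q ≡ zero × lookup τ j < x) ⊎ ∃ λ j′ → q ≡ suc j′ × Inverted τ j j′
    inverted-tail {j} {zero}  (inj₂ e) = inj₁ (refl , inversion-◂-head⁻ x τ j e)
    inverted-tail {j} {suc _} h        = inj₂ (_ , refl , inverted-◂⁻ x τ h)

    no-new-degree-3 : ∀ p q₁ q₂ q₃ → Inverted g p q₁ → Inverted g p q₂ → Inverted g p q₃ →
                      q₁ ≢ q₂ → q₁ ≢ q₃ → q₂ ≢ q₃ → ⊥
    no-new-degree-3 zero _ _ _ h₁ h₂ h₃ q₁≢q₂ q₁≢q₃ q₂≢q₃
      with inverted-head h₁ | inverted-head h₂ | inverted-head h₃
    ... | j₁ , refl , v₁ | j₂ , refl , v₂ | j₃ , refl , v₃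
      with pigeonhole (<x⇒<2 v₁) (<x⇒<2 v₂) (<x⇒<2 v₃)
    ... | inj₁ e        = q₁≢q₂ (cong suc (inj _ _ (Fin.toℕ-injective e)))
    ... | inj₂ (inj₁ e) = q₁≢q₃ (cong suc (inj _ _ (Fin.toℕ-injective e)))
    ... | inj₂ (inj₂ e) = q₂≢q₃ (cong suc (inj _ _ (Fin.toℕ-injective e)))
    no-new-degree-3 (suc j) _ _ _ h₁ h₂ h₃ q₁≢q₂ q₁≢q₃ q₂≢q₃
      with inverted-tail h₁ | inverted-tail h₂ | inverted-tail h₃
    ... | inj₁ (refl , _) | inj₁ (refl , _) | _               = q₁≢q₂ refl
    ... | inj₁ (refl , _) | inj₂ _          | inj₁ (refl , _) = q₁≢q₃ refl
    ... | inj₂ _          | inj₁ (refl , _) | inj₁ (refl , _) = q₂≢q₃ refl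
    ... | inj₁ (refl , v) | inj₂ (_ , refl , h) | inj₂ (_ , refl , h′) = q₂≢q₃ (cong suc (unique-partner j v h h′))
    ... | inj₂ (_ , refl , h) | inj₁ (refl , v) | inj₂ (_ , refl , h′) = q₁≢q₃ (cong suc (unique-partner j v h h′))
    ... | inj₂ (_ , refl , h) | inj₂ (_ , refl , h′) | inj₁ (refl , v) = q₁≢q₂ (cong suc (unique-partner j v h h′))
    ... | inj₂ (_ , refl , h₁′) | inj₂ (_ , refl , h₂′) | inj₂ (_ , refl , h₃′) =
      τ.degree≤2 j _ _ _ h₁′ h₂′ h₃′ (q₁≢q₂ ∘ cong suc) (q₁≢q₃ ∘ cong suc) (q₂≢q₃ ∘ cong suc)

    lookup-tail-< : ∀ u v → lookup g (suc u) < lookup g (suc v) → lookup τ u < lookup τ v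
    lookup-tail-< u v gu<gv = punchIn-cancel-< x (subst₂ _<_ (lookup-◂ x τ u) (lookup-◂ x τ v) gu<gv)

    -- A new 321 or 3412 through position 0 would need two values of τ
    -- below x ≤ 2 in increasing order, hence the value 0 after position 0.
    zero-not-after : ∀ {a b c : Fin n} → a < b → lookup τ b < lookup τ c → lookup τ c < x → ⊥
    zero-not-after {b = b} a<b τb<τc τc<x with below-two-chain τb<τc τc<x x≤2
    ... | τb≡0 , x≡2 = ℕ.n≮0 (subst (_ ℕ.<_) (zero-first x≡2 b τb≡0) a<b)

    no-new-321 : ∀ i j k → Inversion g i j → Inversion g j k → ⊥
    no-new-321 zero    (suc a) (suc b) ia ab with inversion-◂⁻ x τ ab
    ... | a<b , τb<τa = zero-not-after a<b τb<τa (inversion-◂-head⁻ x τ a ia)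
    no-new-321 (suc i) (suc j) (suc k) ij jk = τ.avoids321 i j k (inversion-◂⁻ x τ ij) (inversion-◂⁻ x τ jk)

    no-new-3412 : ∀ a b c d → a < b → b < c → c < d →
                  lookup g c < lookup g d → lookup g d < lookup g a → lookup g a < lookup g b → ⊥
    no-new-3412 zero    (suc b) (suc c) (suc d) _ (s≤s b<c) _ v₁ v₂ _ =
      zero-not-after b<c (lookup-tail-< c d v₁) (inversion-◂-head⁻ x τ d (s≤s z≤n , v₂))
    no-new-3412 (suc a) (suc b) (suc c) (suc d) (s≤s a<b) (s≤s b<c) (s≤s c<d) v₁ v₂ v₃ =
      τ.avoids3412 a b c d a<b b<c c<d (lookup-tail-< c d v₁) (lookup-tail-< d a v₂) (lookup-tail-< a b v₃)

  shortCycleFree-◂ : ShortCycleFree (x ◂ τ)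
  shortCycleFree-◂ = record { degree≤2 = no-new-degree-3 ; avoids321 = no-new-321 ; avoids3412 = no-new-3412 }

prependable-zero : ∀ (τ : Perm n) → Prependable zero τ
prependable-zero τ = record { x≤2 = z≤n ; unique-partner = λ _ () ; zero-first = λ () }

private
  lookup-0◂ : ∀ (τ : Perm n) j → toℕ (lookup (# 0 ◂ τ) (suc j)) ≡ suc (toℕ (lookup τ j))
  lookup-0◂ τ j = cong toℕ (lookup-◂ zero τ j)

  suc≮1 : ∀ {m} → ¬ suc m ℕ.< 1
  suc≮1 (s≤s ())

  ¬inversion-from-0 : ∀ (σ : Perm (suc n)) {p q} → lookup σ p ≡ zero → ¬ Inversion σ p q
  ¬inversion-from-0 σ {q = q} σp≡0 (_ , σq<σp) = ℕ.n≮0 (subst (lookup σ q <_) σp≡0 σq<σp)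

  isolated-0-head : ∀ (σ : Perm (suc n)) → lookup σ zero ≡ zero → ∀ {q} → ¬ Inverted σ zero q
  isolated-0-head σ σ₀≡0 (inj₁ e) = ¬inversion-from-0 σ σ₀≡0 e

  partner-of-0-at-1 : ∀ (σ : Perm (2 + n)) → lookup σ (# 1) ≡ zero → ∀ {q} → Inverted σ (# 1) q → q ≡ zero
  partner-of-0-at-1 σ σ₁≡0 (inj₁ e) = ⊥-elim (¬inversion-from-0 σ σ₁≡0 e)
  partner-of-0-at-1 σ σ₁≡0 {zero} (inj₂ _) = refl
  partner-of-0-at-1 σ σ₁≡0 {suc _} (inj₂ (s≤s () , _))

  partner-of-1-at-2 : ∀ (ρ : Perm (2 + n)) → lookup ρ (# 1) ≡ zero →
                      ∀ {q} → Inverted (# 0 ◂ ρ) (# 2) q → q ≡ # 1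
  partner-of-1-at-2 ρ ρ₁≡0 {suc j} (inj₁ (_ , σj<σ₂)) =
    ⊥-elim (suc≮1 (subst₂ ℕ._<_ (lookup-0◂ ρ j)
      (trans (lookup-0◂ ρ (# 1)) (cong (suc ∘ toℕ) ρ₁≡0)) σj<σ₂))
  partner-of-1-at-2 ρ ρ₁≡0 {zero} (inj₂ (_ , σ₂<σ₀)) = ⊥-elim (ℕ.n≮0 σ₂<σ₀)
  partner-of-1-at-2 ρ ρ₁≡0 {suc zero} (inj₂ _) = refl
  partner-of-1-at-2 ρ ρ₁≡0 {suc (suc _)} (inj₂ (s≤s (s≤s ()) , _))

lookup-pathA-1 : ∀ {r} k (τ : Perm r) → lookup (pathA k τ) (# 1) ≡ zero
lookup-pathA-1 zero          τ = refl
lookup-pathA-1 (suc zero)    τ = refl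
lookup-pathA-1 (suc (suc k)) τ = refl

prependable-pathA₀ : ∀ (τ : Perm n) → Prependable (# 1) (# 0 ◂ τ)
prependable-pathA₀ τ = record
  { x≤2            = s≤s z≤n
  ; unique-partner = λ { zero _ h _ → ⊥-elim (isolated-0-head (# 0 ◂ τ) refl h)
                       ; (suc j) σj<1 → ⊥-elim (suc≮1 (subst (ℕ._< 1) (lookup-0◂ τ j) σj<1)) }
  ; zero-first     = λ ()
  }

prependable-pathA₁ : ∀ (τ : Perm n) → Prependable (# 2) (# 0 ◂ # 0 ◂ τ)
prependable-pathA₁ {n} τ = record
  { x≤2            = ℕ.≤-refl
  ; unique-partner = λ { zero _ h _ → ⊥-elim (isolated-0-head σ refl h)
                       ; (suc zero) _ h _ → ⊥-elim (isolated-1 h)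
                       ; (suc (suc j)) σj<2 → ⊥-elim (suc≮1 (ℕ.≤-pred (subst (ℕ._< 2)
                           (trans (lookup-0◂ (# 0 ◂ τ) (suc j)) (cong suc (lookup-0◂ τ j))) σj<2))) }
  ; zero-first     = λ { _ zero _ → refl
                       ; _ (suc j) σj≡0 → ⊥-elim (ℕ.0≢1+n (trans (sym σj≡0) (lookup-0◂ (# 0 ◂ τ) j))) }
  }
  where
  σ : Perm (2 + n)
  σ = # 0 ◂ # 0 ◂ τ
  isolated-1 : ∀ {q} → ¬ Inverted σ (# 1) q
  isolated-1 {suc j} (inj₁ (_ , σj<1)) = suc≮1 (subst (ℕ._< 1) (lookup-0◂ (# 0 ◂ τ) j) σj<1)
  isolated-1 {zero}  (inj₂ (_ , ()))
  isolated-1 {suc _} (inj₂ (s≤s () , _))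

prependable-pathA : ∀ {r} k (τ : Perm r) → Injective (pathA k τ) → Prependable (# 2) (# 0 ◂ pathA k τ)
prependable-pathA {r} k τ inj = record
  { x≤2            = ℕ.≤-refl
  ; unique-partner = λ { zero _ h _ → ⊥-elim (isolated-0-head (# 0 ◂ ρ) refl h)
                       ; (suc j) σj<2 h h′ → at-position-2 j σj<2 h h′ }
  ; zero-first     = λ { _ zero _ → refl
                       ; _ (suc j) σj≡0 → ⊥-elim (ℕ.0≢1+n (trans (sym σj≡0) (lookup-0◂ ρ j))) }
  }
  where
  ρ : Perm (2 + k + r)
  ρ = pathA k τ
  at-position-2 : ∀ j → toℕ (lookup (# 0 ◂ ρ) (suc j)) ℕ.< 2 → ∀ {q q′} →
                  Inverted (# 0 ◂ ρ) (suc j) q → Inverted (# 0 ◂ ρ) (suc j) q′ → q ≡ q′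
  at-position-2 j σj<2 h h′ with inj j (# 1) (trans (Fin.toℕ-injective (ℕ.n<1⇒n≡0
      (ℕ.≤-pred (subst (ℕ._< 2) (lookup-0◂ ρ j) σj<2)))) (sym (lookup-pathA-1 k τ)))
  ... | refl = trans (partner-of-1-at-2 ρ (lookup-pathA-1 k τ) h) (sym (partner-of-1-at-2 ρ (lookup-pathA-1 k τ) h′))

prependable-pathB : ∀ {r} k (τ : Perm r) → Injective (pathA k τ) → Prependable (# 1) (pathA k τ)
prependable-pathB {r} k τ inj = record
  { x≤2            = s≤s z≤n
  ; unique-partner = at-position-1
  ; zero-first     = λ ()
  }
  where
  ρ : Perm (2 + k + r)
  ρ = pathA k τ
  at-position-1 : ∀ j → toℕ (lookup ρ j) ℕ.< 1 → ∀ {q q′} → Inverted ρ j q → Inverted ρ j q′ → q ≡ q′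
  at-position-1 j ρj<1 h h′
    with inj j (# 1) (trans (Fin.toℕ-injective (ℕ.n<1⇒n≡0 ρj<1)) (sym (lookup-pathA-1 k τ)))
  ... | refl = trans (partner-of-0-at-1 ρ (lookup-pathA-1 k τ) h) (sym (partner-of-0-at-1 ρ (lookup-pathA-1 k τ) h′))

shortCycleFree-0◂ : ∀ {τ : Perm n} → IsPerm τ → ShortCycleFree τ → ShortCycleFree (# 0 ◂ τ)
shortCycleFree-0◂ p scf = shortCycleFree-◂ p scf (prependable-zero _)

shortCycleFree-pathA : ∀ {r} k {τ : Perm r} → IsPerm τ → ShortCycleFree τ → ShortCycleFree (pathA k τ)
shortCycleFree-pathA zero {τ} p scf =
  shortCycleFree-◂ (isPerm-◂ _ _ p) (shortCycleFree-0◂ p scf) (prependable-pathA₀ τ)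
shortCycleFree-pathA (suc zero) {τ} p scf =
  shortCycleFree-◂ (isPerm-◂ _ _ (isPerm-◂ _ _ p))
    (shortCycleFree-0◂ (isPerm-◂ _ _ p) (shortCycleFree-0◂ p scf)) (prependable-pathA₁ τ)
shortCycleFree-pathA (suc (suc k)) {τ} p scf =
  shortCycleFree-◂ (isPerm-◂ _ _ pA) (shortCycleFree-0◂ pA (shortCycleFree-pathA k p scf))
    (prependable-pathA k τ (proj₁ pA))
  where
  pA : IsPerm (pathA k τ)
  pA = isPerm-pathA k τ p

shortCycleFree-perm : ∀ (d : Layout n) → ShortCycleFree (perm d)
shortCycleFree-perm [] = record { degree≤2 = λ () ; avoids321 = λ () ; avoids3412 = λ () }
shortCycleFree-perm (fixed d) = shortCycleFree-0◂ (isPerm-perm d) (shortCycleFree-perm d)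
shortCycleFree-perm (blockA k d) = shortCycleFree-pathA k (isPerm-perm d) (shortCycleFree-perm d)
shortCycleFree-perm (blockB k d) =
  shortCycleFree-◂ (isPerm-pathA k _ (isPerm-perm d)) (shortCycleFree-pathA k (isPerm-perm d) (shortCycleFree-perm d))
    (prependable-pathB k (perm d) (proj₁ (isPerm-pathA k _ (isPerm-perm d))))

-- Connectivity

HasInversion : Perm n → Set
HasInversion {n} g = ∃ λ (u : Pair n) → IsInversion g u

DirectSumAt : ℕ → Perm n → Set
DirectSumAt {n} m g = (∀ (p : Fin n) → toℕ p ℕ.< m → toℕ (lookup g p) ℕ.< m) ×
                      (∀ (p : Fin n) → m ℕ.≤ toℕ p → m ℕ.≤ toℕ (lookup g p))

InversionBelow : ℕ → Perm n → Set
InversionBelow {n} m g = ∃ λ (u : Pair n) → IsInversion g u × toℕ (proj₂ u) ℕ.< m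

InversionAbove : ℕ → Perm n → Set
InversionAbove {n} m g = ∃ λ (u : Pair n) → IsInversion g u × m ℕ.≤ toℕ (proj₁ u)

Decomposable : Perm n → Set
Decomposable g = ∃ λ m → DirectSumAt m g × InversionBelow m g × InversionAbove m g

inversion-stays-below : ∀ {m} {g : Perm n} → DirectSumAt m g → ∀ {i j} → Inversion g i j →
                        toℕ i ℕ.< m → toℕ j ℕ.< m
inversion-stays-below {m = m} (below , above) {i} {j} (_ , gj<gi) i<m with ℕ.<-≤-connex (toℕ j) m
... | inj₁ j<m = j<m
... | inj₂ m≤j = ⊥-elim (ℕ.<-asym (below i i<m) (ℕ.≤-<-trans (above j m≤j) gj<gi))

decomposable⇒disconnected : ∀ (g : Perm n) → Decomposable g → ¬ Connected12 (complement g)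
decomposable⇒disconnected {n} g (m , split , ((a , b) , ab , b<m) , ((c , d) , cd , m≤c)) connected =
  ℕ.<-irrefl refl (ℕ.<-≤-trans (ℕ.<-trans (proj₁ cd) d<m) m≤c)
  where
  Below : Pair n → Set
  Below u = toℕ (proj₂ u) ℕ.< m
  below-closed : ∀ {u w} → Adj12 (complement g) u w → Below u → Below w
  below-closed {i , j} {k , l} (u∈V , w∈V , s) j<m with sharedElement (i , j) (k , l) s
  ... | x , x∈u , x∈w = to-w x∈w (from-u x∈u)
    where
    from-u : x ∈ₚ (i , j) → toℕ x ℕ.< m
    from-u (inj₁ refl) = ℕ.<-trans (proj₁ u∈V) j<m
    from-u (inj₂ refl) = j<m
    to-w : x ∈ₚ (k , l) → toℕ x ℕ.< m → toℕ l ℕ.< m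
    to-w (inj₁ refl) k<m = inversion-stays-below {g = g} split (V12-complement⁻ g w∈V) k<m
    to-w (inj₂ refl) l<m = l<m
  d<m : toℕ d ℕ.< m
  d<m = walk-preserves Below below-closed
          (connected (a , b) (c , d) (V12-complement⁺ g ab) (V12-complement⁺ g cd)) b<m

directSum-0 : ∀ (g : Perm n) → DirectSumAt 0 g
directSum-0 g = (λ _ ()) , (λ _ _ → z≤n)

directSum-◂ : ∀ {m} x (τ : Perm n) → DirectSumAt m τ → toℕ x ℕ.≤ m → DirectSumAt (suc m) (x ◂ τ)
directSum-◂ {m = m} x τ (below , above) x≤m = below′ , above′
  where
  below′ : ∀ p → toℕ p ℕ.< suc m → toℕ (lookup (x ◂ τ) p) ℕ.< suc m
  below′ zero    _         = s≤s x≤m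
  below′ (suc p) (s≤s p<m) rewrite lookup-◂ x τ p =
    ℕ.≤-<-trans (punchIn-≤-suc x (lookup τ p)) (s≤s (below p p<m))
  above′ : ∀ p → suc m ℕ.≤ toℕ p → suc m ℕ.≤ toℕ (lookup (x ◂ τ) p)
  above′ (suc p) (s≤s m≤p) rewrite lookup-◂ x τ p | punchIn-≥-shifts x (ℕ.≤-trans x≤m (above p m≤p)) =
    s≤s (above p m≤p)

hasInversion-◂ : ∀ x (τ : Perm n) → HasInversion τ → HasInversion (x ◂ τ)
hasInversion-◂ x τ ((a , b) , ab) = (suc a , suc b) , inversion-◂⁺ x τ ab

inversionBelow-◂ : ∀ {m} x (τ : Perm n) → InversionBelow m τ → InversionBelow (suc m) (x ◂ τ)
inversionBelow-◂ x τ ((a , b) , ab , b<m) = (suc a , suc b) , inversion-◂⁺ x τ ab , s≤s b<m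

inversionAbove-◂ : ∀ {m} x (τ : Perm n) → InversionAbove m τ → InversionAbove (suc m) (x ◂ τ)
inversionAbove-◂ x τ ((a , b) , ab , m≤a) = (suc a , suc b) , inversion-◂⁺ x τ ab , s≤s m≤a

directSum-pathA : ∀ {r} k (τ : Perm r) → DirectSumAt (2 + k) (pathA k τ)
directSum-pathA zero          τ = directSum-◂ _ _ (directSum-◂ _ τ (directSum-0 τ) z≤n) (s≤s z≤n)
directSum-pathA (suc zero)    τ =
  directSum-◂ _ _ (directSum-◂ _ _ (directSum-◂ _ τ (directSum-0 τ) z≤n) z≤n) (s≤s (s≤s z≤n))
directSum-pathA (suc (suc k)) τ = directSum-◂ _ _ (directSum-◂ _ _ (directSum-pathA k τ) z≤n) (s≤s (s≤s z≤n))

inversionAbove-pathA : ∀ {r} k (τ : Perm r) → HasInversion τ → InversionAbove (2 + k) (pathA k τ)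
inversionAbove-pathA zero          τ (u , iu) = inversionAbove-◂ _ _ (inversionAbove-◂ _ τ (u , iu , z≤n))
inversionAbove-pathA (suc zero)    τ (u , iu) =
  inversionAbove-◂ _ _ (inversionAbove-◂ _ _ (inversionAbove-◂ _ τ (u , iu , z≤n)))
inversionAbove-pathA (suc (suc k)) τ h = inversionAbove-◂ _ _ (inversionAbove-◂ _ _ (inversionAbove-pathA k τ h))

inversion-pathA-01 : ∀ {r} k (τ : Perm r) → Inversion (pathA k τ) zero (# 1)
inversion-pathA-01 zero          τ = s≤s z≤n , s≤s z≤n
inversion-pathA-01 (suc zero)    τ = s≤s z≤n , s≤s z≤n
inversion-pathA-01 (suc (suc k)) τ = s≤s z≤n , s≤s z≤n

inversion-pathB-02 : ∀ {r} k (τ : Perm r) → Inversion (pathB k τ) zero (# 2)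
inversion-pathB-02 k τ = inversion-◂-head⁺ (# 1) (pathA k τ) (# 1)
  (subst (λ v → toℕ v ℕ.< 1) (sym (lookup-pathA-1 k τ)) (s≤s z≤n))

¬hasInversion-allFixed : ∀ n → ¬ HasInversion (perm (allFixed n))
¬hasInversion-allFixed (suc n) ((zero , suc j) , e) = ℕ.n≮0 (inversion-◂-head⁻ zero (perm (allFixed n)) j e)
¬hasInversion-allFixed (suc n) ((suc i , suc j) , e) =
  ¬hasInversion-allFixed n (_ , inversion-◂⁻ zero (perm (allFixed n)) e)

data Leading : Layout n → Set where
  onlyA : ∀ {r} k → Leading (blockA k (allFixed r))
  onlyB : ∀ {r} k → Leading (blockB k (allFixed r))

data OneBlock : Layout n → Set where
  fixed   : ∀ {d : Layout n} → OneBlock d → OneBlock (fixed d)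
  leading : ∀ {d : Layout n} → Leading d → OneBlock d

allFixed-or-hasInversion : ∀ (d : Layout n) → d ≡ allFixed n ⊎ HasInversion (perm d)
allFixed-or-hasInversion []           = inj₁ refl
allFixed-or-hasInversion (fixed d) with allFixed-or-hasInversion d
... | inj₁ refl = inj₁ refl
... | inj₂ h    = inj₂ (hasInversion-◂ _ _ h)
allFixed-or-hasInversion (blockA k d) = inj₂ (_ , inversion-pathA-01 k (perm d))
allFixed-or-hasInversion (blockB k d) = inj₂ (_ , inversion-pathB-02 k (perm d))

trichotomy : ∀ (d : Layout n) → d ≡ allFixed n ⊎ OneBlock d ⊎ Decomposable (perm d)
trichotomy [] = inj₁ refl
trichotomy (fixed d) with trichotomy d
... | inj₁ refl                    = inj₁ refl
... | inj₂ (inj₁ one)              = inj₂ (inj₁ (fixed one))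
... | inj₂ (inj₂ (m , s , lo , hi)) =
  inj₂ (inj₂ (suc m , directSum-◂ _ _ s z≤n , inversionBelow-◂ _ _ lo , inversionAbove-◂ _ _ hi))
trichotomy (blockA k d) with allFixed-or-hasInversion d
... | inj₁ refl = inj₂ (inj₁ (leading (onlyA k)))
... | inj₂ h    = inj₂ (inj₂ (2 + k , directSum-pathA k (perm d) ,
                    (_ , inversion-pathA-01 k (perm d) , s≤s (s≤s z≤n)) , inversionAbove-pathA k (perm d) h))
trichotomy (blockB k d) with allFixed-or-hasInversion d
... | inj₁ refl = inj₂ (inj₁ (leading (onlyB k)))
... | inj₂ h    = inj₂ (inj₂ (3 + k , directSum-◂ _ _ (directSum-pathA k (perm d)) (s≤s z≤n) ,
                    (_ , inversion-pathB-02 k (perm d) , s≤s (s≤s (s≤s z≤n))) ,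
                    inversionAbove-◂ _ _ (inversionAbove-pathA k (perm d) h)))

connected-if-no-inversion : ∀ (g : Perm n) → ¬ HasInversion g → Connected12 (complement g)
connected-if-no-inversion g none u _ u∈V _ = ⊥-elim (none (u , V12-complement⁻ g u∈V))

module _ (x : Fin (suc n)) (τ : Perm n) where

  V12-◂⁺ : ∀ {a b} → V12 (complement τ) (a , b) → V12 (complement (x ◂ τ)) (suc a , suc b)
  V12-◂⁺ ab = V12-complement⁺ (x ◂ τ) (inversion-◂⁺ x τ (V12-complement⁻ τ ab))

  walk-◂⁺ : ∀ {a b c d} → Walk (complement τ) (a , b) (c , d) →
            Walk (complement (x ◂ τ)) (suc a , suc b) (suc c , suc d)
  walk-◂⁺ (here ab)                           = here (V12-◂⁺ ab)
  walk-◂⁺ (step {w = _ , _} (ab , kl , s) p) = step (V12-◂⁺ ab , V12-◂⁺ kl , shareExactlyOne-suc s) (walk-◂⁺ p)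

connected-0◂ : ∀ (τ : Perm n) → Connected12 (complement τ) → Connected12 (complement (# 0 ◂ τ))
connected-0◂ τ connected u v u∈V v∈V =
  reach u v (V12-complement⁻ (# 0 ◂ τ) u∈V) (V12-complement⁻ (# 0 ◂ τ) v∈V)
  where
  reach : ∀ u v → IsInversion (# 0 ◂ τ) u → IsInversion (# 0 ◂ τ) v → Walk (complement (# 0 ◂ τ)) u v
  reach (zero , suc j) _ e _ = ⊥-elim (ℕ.n≮0 (inversion-◂-head⁻ zero τ j e))
  reach (suc _ , suc _) (zero , suc l) _ e = ⊥-elim (ℕ.n≮0 (inversion-◂-head⁻ zero τ l e))
  reach (suc i , suc j) (suc k , suc l) e e′ = walk-◂⁺ (# 0) τ
    (connected (i , j) (k , l) (V12-complement⁺ τ (inversion-◂⁻ zero τ e))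
                               (V12-complement⁺ τ (inversion-◂⁻ zero τ e′)))

-- When x > 0, the new vertex {0, j₀+1} with τ(j₀) = 0 serves as a hub: every
-- new vertex {0, j+1} shares 0 with it, and the old component is attached to
-- it through an old vertex containing a position j with τ(j) < x.
module Hub {m} (x : Fin (2 + m)) (τ : Perm (suc m)) (0<x : 0 ℕ.< toℕ x)
  (j₀ : Fin (suc m)) (τj₀≡0 : lookup τ j₀ ≡ zero) (connected : Connected12 (complement τ))
  (attached : HasInversion τ → ∃ λ u → IsInversion τ u × ∃ λ j → j ∈ₚ u × lookup τ j < x) where

  private
    g : Perm (2 + m)
    g = x ◂ τ

    hub : Pair (2 + m)
    hub = zero , suc j₀

    hub-inversion : IsInversion g hub
    hub-inversion = inversion-◂-head⁺ x τ j₀ (subst (_< x) (sym τj₀≡0) 0<x)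

    to-hub-from-head : ∀ j → lookup τ j < x → Walk (complement g) (zero , suc j) hub
    to-hub-from-head j τj<x with j Fin.≟ j₀
    ... | yes refl = here (V12-complement⁺ g hub-inversion)
    ... | no j≢j₀ = step (V12-complement⁺ g (inversion-◂-head⁺ x τ j τj<x) , V12-complement⁺ g hub-inversion ,
                          shareExactlyOne _ _ (j≢j₀ ∘ Fin.suc-injective ∘ cong proj₂) (inj₁ refl) (inj₁ refl))
                         (here (V12-complement⁺ g hub-inversion))

    to-hub : ∀ u → IsInversion g u → Walk (complement g) u hub
    to-hub (zero , suc j) e = to-hub-from-head j (inversion-◂-head⁻ x τ j e)
    to-hub (suc a , suc b) e with attached (_ , inversion-◂⁻ x τ e)
    ... | (c , d) , cd , j , j∈cd , τj<x =
      walk-◂⁺ x τ (connected (a , b) (c , d) (V12-complement⁺ τ (inversion-◂⁻ x τ e)) (V12-complement⁺ τ cd))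
      ++ʷ step (V12-◂⁺ x τ (V12-complement⁺ τ cd) , V12-complement⁺ g (inversion-◂-head⁺ x τ j τj<x) ,
                shareExactlyOne _ (zero , suc j) (λ ()) (∈ₚ-suc j∈cd) (inj₂ refl))
               (to-hub-from-head j τj<x)

  connected-◂ : Connected12 (complement g)
  connected-◂ u v u∈V v∈V =
    to-hub u (V12-complement⁻ g u∈V) ++ʷ reverseʷ (to-hub v (V12-complement⁻ g v∈V))

private
  ι : ∀ r → Perm r
  ι r = perm (allFixed r)

connected-pathA : ∀ {r} k → Connected12 (complement (pathA k (ι r)))
connected-pathA {r} zero = Hub.connected-◂ (# 1) (ι (suc r)) (s≤s z≤n) zero refl
  (connected-if-no-inversion _ (¬hasInversion-allFixed (suc r))) (⊥-elim ∘ ¬hasInversion-allFixed (suc r))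
connected-pathA {r} (suc zero) = Hub.connected-◂ (# 2) (ι (2 + r)) (s≤s z≤n) zero refl
  (connected-if-no-inversion _ (¬hasInversion-allFixed (2 + r))) (⊥-elim ∘ ¬hasInversion-allFixed (2 + r))
connected-pathA {r} (suc (suc k)) = Hub.connected-◂ (# 2) (# 0 ◂ pathA k (ι r)) (s≤s z≤n) zero refl
  (connected-0◂ _ (connected-pathA k))
  (λ _ → (suc zero , suc (suc zero)) , inversion-◂⁺ zero (pathA k (ι r)) (inversion-pathA-01 k (ι r)) ,
         suc (suc zero) , inj₂ refl , value-1<2)
  where
  value-1<2 : toℕ (lookup (# 0 ◂ pathA k (ι r)) (# 2)) ℕ.< 2
  value-1<2 rewrite lookup-◂ zero (pathA k (ι r)) (# 1) | lookup-pathA-1 k (ι r) = s≤s (s≤s z≤n)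

connected-pathB : ∀ {r} k → Connected12 (complement (pathB k (ι r)))
connected-pathB {r} k = Hub.connected-◂ (# 1) (pathA k (ι r)) (s≤s z≤n) (# 1) (lookup-pathA-1 k (ι r))
  (connected-pathA k)
  (λ _ → (zero , # 1) , inversion-pathA-01 k (ι r) , # 1 , inj₂ refl ,
         subst (λ v → toℕ v ℕ.< 1) (sym (lookup-pathA-1 k (ι r))) (s≤s z≤n))

connected-oneBlock : ∀ {d : Layout n} → OneBlock d → Connected12 (complement (perm d))
connected-oneBlock (fixed one) = connected-0◂ _ (connected-oneBlock one)
connected-oneBlock (leading (onlyA k)) = connected-pathA k
connected-oneBlock (leading (onlyB k)) = connected-pathB k

hasInversion-oneBlock : ∀ {d : Layout n} → OneBlock d → HasInversion (perm d)
hasInversion-oneBlock (fixed one) = hasInversion-◂ _ _ (hasInversion-oneBlock one)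
hasInversion-oneBlock (leading (onlyA k)) = _ , inversion-pathA-01 k _
hasInversion-oneBlock (leading (onlyB k)) = _ , inversion-pathB-02 k _

oneBlock⇒tree : ∀ {d : Layout n} → OneBlock d → IsPerm (complement (perm d)) × IsTree12 (complement (perm d))
oneBlock⇒tree {d = d} one =
  isPerm-complement (perm d) (isPerm-perm d) ,
  nonempty (hasInversion-oneBlock one) , connected-oneBlock one ,
  shortCycleFree⇒acyclic (perm d) (proj₁ (isPerm-perm d)) (shortCycleFree-perm d)
  where
  nonempty : HasInversion (perm d) → ∃ λ u → V12 (complement (perm d)) u
  nonempty (u , u-inv) = u , V12-complement⁺ (perm d) u-inv

tree⇒oneBlock : ∀ (g : Perm n) → IsPerm g → IsTree12 (complement g) → ∃ λ d → OneBlock d × perm d ≡ g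
tree⇒oneBlock {n} g pg ((u , u∈V) , connected , acyclic) =
  layout g , by-trichotomy (trichotomy (layout g)) , perm-layout-g
  where
  perm-layout-g : perm (layout g) ≡ g
  perm-layout-g = perm-layout g pg (ShortCycles.acyclic⇒shortCycleFree g acyclic)
  by-trichotomy : layout g ≡ allFixed n ⊎ OneBlock (layout g) ⊎ Decomposable (perm (layout g)) →
                  OneBlock (layout g)
  by-trichotomy (inj₁ layout≡) = ⊥-elim (¬hasInversion-allFixed n
    (subst HasInversion (trans (sym perm-layout-g) (cong perm layout≡)) (u , V12-complement⁻ g u∈V)))
  by-trichotomy (inj₂ (inj₁ one)) = one
  by-trichotomy (inj₂ (inj₂ dec)) =
    ⊥-elim (decomposable⇒disconnected g (subst Decomposable perm-layout-g dec) connected)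

-- Counting one-block layouts

-- Lengthens a leading block by one.
grow : Layout (2 + n) → Layout (3 + n)
grow (fixed d)    = fixed (fixed d)
grow (blockA k d) = blockA (suc k) d
grow (blockB k d) = blockB (suc k) d

leadings : ∀ n → List (Layout n)
leadings zero                = []
leadings (suc zero)          = []
leadings (suc (suc zero))    = blockA 0 [] ∷ []
leadings (suc (suc (suc r))) =
  blockA 0 (allFixed (suc r)) ∷ blockB 0 (allFixed r) ∷ List.map grow (leadings (suc (suc r)))

oneBlocks : ∀ n → List (Layout n)
oneBlocks zero    = []
oneBlocks (suc n) = List.map fixed (oneBlocks n) ++ leadings (suc n)

leading-grow : ∀ {d : Layout (2 + n)} → Leading d → Leading (grow d)
leading-grow (onlyA k) = onlyA (suc k)
leading-grow (onlyB k) = onlyB (suc k)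

∈-leadings⁻ : ∀ n {d} → d ∈ leadings n → Leading d
∈-leadings⁻ (suc (suc zero))    (here refl)         = onlyA 0
∈-leadings⁻ (suc (suc (suc r))) (here refl)         = onlyA 0
∈-leadings⁻ (suc (suc (suc r))) (there (here refl)) = onlyB 0
∈-leadings⁻ (suc (suc (suc r))) (there (there d∈)) = ∈-map-grow⁻ (∈-leadings⁻ (suc (suc r))) d∈
  where
  ∈-map-grow⁻ : ∀ {xs : List (Layout (2 + r))} → (∀ {d} → d ∈ xs → Leading d) →
                ∀ {d} → d ∈ List.map grow xs → Leading d
  ∈-map-grow⁻ {xs} leading-xs d∈ with ∈-map⁻ grow {xs = xs} d∈
  ... | _ , d′∈ , refl = leading-grow (leading-xs d′∈)

∈-leadings⁺ : ∀ {d : Layout n} → Leading d → d ∈ leadings n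
∈-leadings⁺ (onlyA {zero}  zero) = here refl
∈-leadings⁺ (onlyA {suc r} zero) = here refl
∈-leadings⁺ (onlyA (suc k))      = there (there (∈-map⁺ grow (∈-leadings⁺ (onlyA k))))
∈-leadings⁺ (onlyB zero)         = there (here refl)
∈-leadings⁺ (onlyB (suc k))      = there (there (∈-map⁺ grow (∈-leadings⁺ (onlyB k))))

∈-oneBlocks⁻ : ∀ n {d} → d ∈ oneBlocks n → OneBlock d
∈-oneBlocks⁻ (suc n) d∈ with ∈-++⁻ (List.map fixed (oneBlocks n)) d∈
... | inj₂ d∈leadings = leading (∈-leadings⁻ (suc n) d∈leadings)
... | inj₁ d∈fixed with ∈-map⁻ fixed d∈fixed
...   | _ , d′∈ , refl = fixed (∈-oneBlocks⁻ n d′∈)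

∈-oneBlocks⁺ : ∀ {d : Layout n} → OneBlock d → d ∈ oneBlocks n
∈-oneBlocks⁺ (fixed one) = ∈-++⁺ˡ (∈-map⁺ fixed (∈-oneBlocks⁺ one))
∈-oneBlocks⁺ {suc n} (leading l) = ∈-++⁺ʳ (List.map fixed (oneBlocks n)) (∈-leadings⁺ l)

private
  ungrow : Layout n → Layout (ℕ.pred n)
  ungrow (fixed (fixed d))  = fixed d
  ungrow (blockA (suc k) d) = blockA k d
  ungrow (blockB (suc k) d) = blockB k d
  ungrow {n} _              = allFixed (ℕ.pred n)

  ungrow-grow : ∀ (d : Layout (2 + n)) → ungrow (grow d) ≡ d
  ungrow-grow (fixed d)    = refl
  ungrow-grow (blockA k d) = refl
  ungrow-grow (blockB k d) = refl

grow-injective : ∀ {d d′ : Layout (2 + n)} → grow d ≡ grow d′ → d ≡ d′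
grow-injective {d = d} {d′} eq = trans (sym (ungrow-grow d)) (trans (cong ungrow eq) (ungrow-grow d′))

unique-leadings : ∀ n → Unique (leadings n)
unique-leadings zero                = []
unique-leadings (suc zero)          = []
unique-leadings (suc (suc zero))    = [] ∷ []
unique-leadings (suc (suc (suc r))) =
  ((λ ()) ∷ All.map⁺ (All.universal blockA₀≢grow _)) ∷ All.map⁺ (All.universal blockB₀≢grow _) ∷
  Unique.map⁺ grow-injective (unique-leadings (suc (suc r)))
  where
  blockA₀≢grow : ∀ x → blockA 0 (allFixed (suc r)) ≢ grow x
  blockA₀≢grow (fixed _)    ()
  blockA₀≢grow (blockA _ _) ()
  blockA₀≢grow (blockB _ _) ()
  blockB₀≢grow : ∀ x → blockB 0 (allFixed r) ≢ grow x
  blockB₀≢grow (fixed _)    ()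
  blockB₀≢grow (blockA _ _) ()
  blockB₀≢grow (blockB _ _) ()

fixed-injective : ∀ {d d′ : Layout n} → fixed d ≡ fixed d′ → d ≡ d′
fixed-injective refl = refl

unique-oneBlocks : ∀ n → Unique (oneBlocks n)
unique-oneBlocks zero    = []
unique-oneBlocks (suc n) =
  Unique.++⁺ (Unique.map⁺ fixed-injective (unique-oneBlocks n)) (unique-leadings (suc n)) disjoint
  where
  disjoint : ∀ {v} → ¬ (v ∈ List.map fixed (oneBlocks n) × v ∈ leadings (suc n))
  disjoint (v∈fixed , v∈leadings) with ∈-map⁻ fixed v∈fixed | ∈-leadings⁻ (suc n) v∈leadings
  ... | _ , _ , refl | ()

length-leadings : ∀ r → length (leadings (2 + r)) ≡ 1 + 2 * r
length-leadings zero    = refl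
length-leadings (suc r) = begin
  2 + length (List.map grow (leadings (2 + r))) ≡⟨ cong (2 +_) (List.length-map grow (leadings (2 + r))) ⟩
  2 + length (leadings (2 + r))                 ≡⟨ cong (2 +_) (length-leadings r) ⟩
  2 + (1 + 2 * r)                               ≡⟨ cong suc (ℕ.*-suc 2 r) ⟨
  1 + 2 * suc r                                 ∎
  where open ≡-Reasoning

length-oneBlocks : ∀ n → length (oneBlocks n) ≡ (n ∸ 1) ^ 2
length-oneBlocks zero          = refl
length-oneBlocks (suc zero)    = refl
length-oneBlocks (suc (suc r)) = begin
  length (List.map fixed (oneBlocks (suc r)) ++ leadings (2 + r))
    ≡⟨ List.length-++ (List.map fixed (oneBlocks (suc r))) ⟩
  length (List.map fixed (oneBlocks (suc r))) + length (leadings (2 + r))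
    ≡⟨ cong₂ _+_ (trans (List.length-map fixed (oneBlocks (suc r))) (length-oneBlocks (suc r))) (length-leadings r) ⟩
  r ^ 2 + (1 + 2 * r)
    ≡⟨ square-suc r ⟩
  suc r ^ 2 ∎
  where
  open ≡-Reasoning
  -- m ^ 2 unfolded to m * (m * 1), which the ring solver can read
  square-suc : ∀ m → m * (m * 1) + (1 + 2 * m) ≡ suc m * (suc m * 1)
  square-suc = solve-∀

complement-injective : ∀ {g h : Perm n} → complement g ≡ complement h → g ≡ h
complement-injective {g = g} {h} eq =
  trans (sym (complement-involutive g)) (trans (cong complement eq) (complement-involutive h))

theorem6p3 : (n : ℕ) → 1 ≤ n →
    HasCount {n} (λ π → IsPerm π × IsTree12 π) ((n ∸ 1) ^ 2)
theorem6p3 n _ =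
  trees ,
  Unique.map⁺ (perm-injective ∘ complement-injective) (unique-oneBlocks n) ,
  trans (List.length-map (complement ∘ perm) (oneBlocks n)) (length-oneBlocks n) ,
  λ π → mk⇔ (tree-if-listed π) (listed-if-tree π)
  where
  trees : List (Perm n)
  trees = List.map (complement ∘ perm) (oneBlocks n)
  tree-if-listed : ∀ π → π ∈ trees → IsPerm π × IsTree12 π
  tree-if-listed π π∈ with ∈-map⁻ (complement ∘ perm) π∈
  ... | _ , d∈ , refl = oneBlock⇒tree (∈-oneBlocks⁻ n d∈)
  listed-if-tree : ∀ π → IsPerm π × IsTree12 π → π ∈ trees
  listed-if-tree π (pπ , tree)
    with tree⇒oneBlock (complement π) (isPerm-complement π pπ)
           (subst IsTree12 (sym (complement-involutive π)) tree)
  ... | d , one , perm-d≡ = subst (_∈ trees) (trans (cong complement perm-d≡) (complement-involutive π))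
                               (∈-map⁺ (complement ∘ perm) (∈-oneBlocks⁺ one))
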